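{- Let $c \ge 2$ be an integer. Then there is no lattice triangle $T \subseteq \mathbb{R}^2$ such that the pair $(b,i) = (b(T), i(T))$ satisfies \[ \tfrac{c-1}{2}\, b - (c-1) \;<\; i \;<\; \tfrac{c}{2}\, b - c(c+2). \] Equivalently, $\mathcal{T} \cap \sigma_c^\circ = \emptyset$ for every integer $c \ge 2$, where $\mathcal{T} = \{(b(T), i(T)) : T \text{ a lattice triangle}\}$ and $\sigma_c^\circ = \{(b,i) \in \mathbb{R}_{\ge 0}^2 : \tfrac{c-1}{2} b - (c-1) < i < \tfrac{c}{2} b - c(c+2)\}$.
   Context: A lattice polygon is the two-dimensional convex hull of finitely many points of $\mathbb{Z}^2$; a lattice triangle is a lattice polygon with three vertices. For a lattice polygon $P$, $b(P)$ denotes the number of lattice points (points of $\mathbb{Z}^2$) on the boundary of $P$, and $i(P)$ denotes the number of lattice points in the interior of $P$. -}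

module Defs where

open import Data.Nat using (ℕ; suc)
open import Data.Integer using (ℤ; +_; _+_; _-_; _*_; _≤_; _<_; _≤?_; _<?_; _⊓_; _⊔_; ∣_∣; 0ℤ)
open import Data.Product using (_×_; _,_)
open import Data.List using (List; map; upTo; cartesianProduct; filter; length)
open import Relation.Nullary using (¬_; Dec)
open import Relation.Nullary.Decidable using (_×-dec_; ¬?)
open import Relation.Binary.PropositionalEquality using (_≡_)

Point : Set
Point = ℤ × ℤ

det : Point → Point → Point → ℤ
det (ax , ay) (bx , by) (cx , cy) = (bx - ax) * (cy - ay) - (by - ay) * (cx - ax)

record LatticeTriangle : Set where
  constructor triangle
  field
    v₁ v₂ v₃ : Point
    nondegenerate : ¬ (det v₁ v₂ v₃ ≡ 0ℤ)
open LatticeTriangle public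

-- x lies in the closed triangle iff each barycentric numerator has the same
-- sign as the total (nonzero) determinant, or is zero.
InT : LatticeTriangle → Point → Set
InT T x = (0ℤ ≤ D * det x (v₂ T) (v₃ T)) × (0ℤ ≤ D * det (v₁ T) x (v₃ T)) × (0ℤ ≤ D * det (v₁ T) (v₂ T) x)
  where D = det (v₁ T) (v₂ T) (v₃ T)

InInterior : LatticeTriangle → Point → Set
InInterior T x = (0ℤ < D * det x (v₂ T) (v₃ T)) × (0ℤ < D * det (v₁ T) x (v₃ T)) × (0ℤ < D * det (v₁ T) (v₂ T) x)
  where D = det (v₁ T) (v₂ T) (v₃ T)

OnBoundary : LatticeTriangle → Point → Set
OnBoundary T x = InT T x × ¬ InInterior T x

inT? : (T : LatticeTriangle) → (x : Point) → Dec (InT T x)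
inT? T x = (0ℤ ≤? D * det x (v₂ T) (v₃ T)) ×-dec ((0ℤ ≤? D * det (v₁ T) x (v₃ T)) ×-dec (0ℤ ≤? D * det (v₁ T) (v₂ T) x))
  where D = det (v₁ T) (v₂ T) (v₃ T)

inInterior? : (T : LatticeTriangle) → (x : Point) → Dec (InInterior T x)
inInterior? T x = (0ℤ <? D * det x (v₂ T) (v₃ T)) ×-dec ((0ℤ <? D * det (v₁ T) x (v₃ T)) ×-dec (0ℤ <? D * det (v₁ T) (v₂ T) x))
  where D = det (v₁ T) (v₂ T) (v₃ T)

onBoundary? : (T : LatticeTriangle) → (x : Point) → Dec (OnBoundary T x)
onBoundary? T x = inT? T x ×-dec ¬? (inInterior? T x)

range : ℤ → ℤ → List ℤ
range lo hi = map (λ k → lo + + k) (upTo (suc ∣ hi - lo ∣))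

-- All lattice points of the axis-parallel bounding box of T (contains every
-- lattice point of T, each exactly once).
boxPoints : LatticeTriangle → List Point
boxPoints T with v₁ T | v₂ T | v₃ T
... | (x₁ , y₁) | (x₂ , y₂) | (x₃ , y₃) =
  cartesianProduct (range (x₁ ⊓ x₂ ⊓ x₃) (x₁ ⊔ x₂ ⊔ x₃))
                   (range (y₁ ⊓ y₂ ⊓ y₃) (y₁ ⊔ y₂ ⊔ y₃))

b : LatticeTriangle → ℕ
b T = length (filter (onBoundary? T) (boxPoints T))

i : LatticeTriangle → ℕ
i T = length (filter (inInterior? T) (boxPoints T))

-- Both b and i are invariant under reordering the vertices and under unimodular affine maps of
-- ℤ², and such a map sends every lattice triangle, listed with an edge of largest lattice length
-- e first, to the triangle with vertices (0 , 0), (0 , e), (h , e + r). Counting the lattice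
-- points of the latter column by column gives b = e + gcd(h, e + r) + gcd(h, r) and Pick's
-- formula 2 i + b = e h + 2. The two gcds g₂, g₃ divide h and are at most e, and in these terms
-- the hypotheses say c b < e h + 2 c and e h + 2 (c + 1)² < (c + 1) b; a case analysis on whether
-- g₂ and g₃ equal h shows that these cannot hold together.
module Submission where

module Counting where

  open import Defs
  open import Data.Nat as ℕ using (ℕ)
  open import Data.Integer as ℤ using (ℤ; +_; -[1+_]; +[1+_]; _+_; _-_; _*_; -_; _≤_; _<_; ∣_∣; 0ℤ; _⊓_; _⊔_; +≤+; +<+)
  import Data.Integer.Properties as ℤP
  open import Data.Integer.Tactic.RingSolver
  open import Data.Product using (_×_; _,_; proj₁; proj₂)
  open import Data.List using (List; map; filter; length)
  open import Data.List.Properties using (length-map)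
  open import Data.List.Membership.Propositional using (_∈_)
  open import Data.List.Membership.Propositional.Properties
  open import Data.List.Membership.Propositional.Properties.WithK using (unique∧set⇒bag)
  open import Data.List.Relation.Unary.Unique.Propositional using (Unique)
  import Data.List.Relation.Unary.Unique.Propositional.Properties as Unique
  open import Data.List.Relation.Binary.BagAndSetEquality using (∼bag⇒↭)
  open import Data.List.Relation.Binary.Permutation.Propositional.Properties using (↭-length)
  open import Relation.Nullary using (¬_)
  open import Relation.Unary using (Decidable)
  open import Relation.Binary.PropositionalEquality
  open import Function.Bundles using (_⇔_; mk⇔; Equivalence)

  unique∧set⇒length≡ : ∀ {A : Set} {xs ys : List A} → Unique xs → Unique ys →
    (∀ {x} → x ∈ xs ⇔ x ∈ ys) → length xs ≡ length ys
  unique∧set⇒length≡ u v eq = ↭-length (∼bag⇒↭ (unique∧set⇒bag u v eq))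

  0≤i⇒0≤j⇒0≤i*j : ∀ {i j} → 0ℤ ≤ i → 0ℤ ≤ j → 0ℤ ≤ i * j
  0≤i⇒0≤j⇒0≤i*j {+ m} {+ n} _ _ = subst (0ℤ ≤_) (ℤP.pos-* m n) (+≤+ ℕ.z≤n)

  i≢0⇒0<i*i : ∀ i → ¬ i ≡ 0ℤ → 0ℤ < i * i
  i≢0⇒0<i*i (+ ℕ.zero) i≢0 with () ← i≢0 refl
  i≢0⇒0<i*i +[1+ n ] _ = +<+ (ℕ.s≤s ℕ.z≤n)
  i≢0⇒0<i*i -[1+ n ] _ = +<+ (ℕ.s≤s ℕ.z≤n)

  0<k⇒0≤k*i⇒0≤i : ∀ k i → 0ℤ < k → 0ℤ ≤ k * i → 0ℤ ≤ i
  0<k⇒0≤k*i⇒0≤i (+ ℕ.zero) i (+<+ ()) _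
  0<k⇒0≤k*i⇒0≤i -[1+ k ] i () _
  0<k⇒0≤k*i⇒0≤i +[1+ k ] (+ n) _ _ = +≤+ ℕ.z≤n
  0<k⇒0≤k*i⇒0≤i +[1+ k ] -[1+ n ] _ ()

  weighted-mean-lower-bound : ∀ {K u₁ u₂ u₃ p q r x m} → 0ℤ < K →
    0ℤ ≤ u₁ → 0ℤ ≤ u₂ → 0ℤ ≤ u₃ → K ≡ u₁ + u₂ + u₃ → K * x ≡ u₁ * p + u₂ * q + u₃ * r →
    m ≤ p → m ≤ q → m ≤ r → m ≤ x
  weighted-mean-lower-bound {K} {u₁} {u₂} {u₃} {p} {q} {r} {x} {m} 0<K 0≤u₁ 0≤u₂ 0≤u₃ K≡ Kx≡ m≤p m≤q m≤r =
    ℤP.0≤i-j⇒j≤i (0<k⇒0≤k*i⇒0≤i K (x - m) 0<K (subst (0ℤ ≤_) (sym K[x-m]≡) 0≤sum))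
    where
    shift : ∀ K u₁ u₂ u₃ p q r x m → K ≡ u₁ + u₂ + u₃ → K * x ≡ u₁ * p + u₂ * q + u₃ * r →
      K * (x - m) ≡ u₁ * (p - m) + u₂ * (q - m) + u₃ * (r - m)
    shift K u₁ u₂ u₃ p q r x m refl e = trans (expand (u₁ + u₂ + u₃) x m) (trans (cong (_- (u₁ + u₂ + u₃) * m) e) (regroup u₁ u₂ u₃ p q r m))
      where
      expand : ∀ K x m → K * (x - m) ≡ K * x - K * m
      expand = solve-∀
      regroup : ∀ u₁ u₂ u₃ p q r m → u₁ * p + u₂ * q + u₃ * r - (u₁ + u₂ + u₃) * m ≡ u₁ * (p - m) + u₂ * (q - m) + u₃ * (r - m)
      regroup = solve-∀
    K[x-m]≡ : K * (x - m) ≡ u₁ * (p - m) + u₂ * (q - m) + u₃ * (r - m)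
    K[x-m]≡ = shift K u₁ u₂ u₃ p q r x m K≡ Kx≡
    term : ∀ {u a} → 0ℤ ≤ u → m ≤ a → 0ℤ ≤ u * (a - m)
    term 0≤u m≤a = 0≤i⇒0≤j⇒0≤i*j 0≤u (ℤP.i≤j⇒0≤j-i m≤a)
    0≤sum : 0ℤ ≤ u₁ * (p - m) + u₂ * (q - m) + u₃ * (r - m)
    0≤sum = ℤP.+-mono-≤ (ℤP.+-mono-≤ (term 0≤u₁ m≤p) (term 0≤u₂ m≤q)) (term 0≤u₃ m≤r)

  weighted-mean-upper-bound : ∀ {K u₁ u₂ u₃ p q r x m} → 0ℤ < K →
    0ℤ ≤ u₁ → 0ℤ ≤ u₂ → 0ℤ ≤ u₃ → K ≡ u₁ + u₂ + u₃ → K * x ≡ u₁ * p + u₂ * q + u₃ * r →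
    p ≤ m → q ≤ m → r ≤ m → x ≤ m
  weighted-mean-upper-bound {K} {u₁} {u₂} {u₃} {p} {q} {r} {x} 0<K 0≤u₁ 0≤u₂ 0≤u₃ K≡ Kx≡ p≤m q≤m r≤m =
    ℤP.neg-cancel-≤ (weighted-mean-lower-bound 0<K 0≤u₁ 0≤u₂ 0≤u₃ K≡ K[-x]≡
      (ℤP.neg-mono-≤ p≤m) (ℤP.neg-mono-≤ q≤m) (ℤP.neg-mono-≤ r≤m))
    where
    negate : ∀ K u₁ u₂ u₃ p q r x → K * x ≡ u₁ * p + u₂ * q + u₃ * r →
      K * - x ≡ u₁ * - p + u₂ * - q + u₃ * - r
    negate K u₁ u₂ u₃ p q r x e = trans (pull K x) (trans (cong -_ e) (push u₁ u₂ u₃ p q r))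
      where
      pull : ∀ K x → K * - x ≡ - (K * x)
      pull = solve-∀
      push : ∀ u₁ u₂ u₃ p q r → - (u₁ * p + u₂ * q + u₃ * r) ≡ u₁ * - p + u₂ * - q + u₃ * - r
      push = solve-∀
    K[-x]≡ : K * - x ≡ u₁ * - p + u₂ * - q + u₃ * - r
    K[-x]≡ = negate K u₁ u₂ u₃ p q r x Kx≡

  det-cramer-sum : ∀ a b c x → det x b c + det a x c + det a b x ≡ det a b c
  det-cramer-sum (a₁ , a₂) (b₁ , b₂) (c₁ , c₂) (x₁ , x₂) = identity a₁ a₂ b₁ b₂ c₁ c₂ x₁ x₂
    where
    identity : ∀ a₁ a₂ b₁ b₂ c₁ c₂ x₁ x₂ →
      ((b₁ - x₁) * (c₂ - x₂) - (b₂ - x₂) * (c₁ - x₁)) + ((x₁ - a₁) * (c₂ - a₂) - (x₂ - a₂) * (c₁ - a₁))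
        + ((b₁ - a₁) * (x₂ - a₂) - (b₂ - a₂) * (x₁ - a₁))
      ≡ (b₁ - a₁) * (c₂ - a₂) - (b₂ - a₂) * (c₁ - a₁)
    identity = solve-∀

  det-cramer₁ : ∀ a b c x → det a b c * proj₁ x ≡ det x b c * proj₁ a + det a x c * proj₁ b + det a b x * proj₁ c
  det-cramer₁ (a₁ , a₂) (b₁ , b₂) (c₁ , c₂) (x₁ , x₂) = identity a₁ a₂ b₁ b₂ c₁ c₂ x₁ x₂
    where
    identity : ∀ a₁ a₂ b₁ b₂ c₁ c₂ x₁ x₂ →
      ((b₁ - a₁) * (c₂ - a₂) - (b₂ - a₂) * (c₁ - a₁)) * x₁
      ≡ ((b₁ - x₁) * (c₂ - x₂) - (b₂ - x₂) * (c₁ - x₁)) * a₁ + ((x₁ - a₁) * (c₂ - a₂) - (x₂ - a₂) * (c₁ - a₁)) * b₁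
        + ((b₁ - a₁) * (x₂ - a₂) - (b₂ - a₂) * (x₁ - a₁)) * c₁
    identity = solve-∀

  det-cramer₂ : ∀ a b c x → det a b c * proj₂ x ≡ det x b c * proj₂ a + det a x c * proj₂ b + det a b x * proj₂ c
  det-cramer₂ (a₁ , a₂) (b₁ , b₂) (c₁ , c₂) (x₁ , x₂) = identity a₁ a₂ b₁ b₂ c₁ c₂ x₁ x₂
    where
    identity : ∀ a₁ a₂ b₁ b₂ c₁ c₂ x₁ x₂ →
      ((b₁ - a₁) * (c₂ - a₂) - (b₂ - a₂) * (c₁ - a₁)) * x₂
      ≡ ((b₁ - x₁) * (c₂ - x₂) - (b₂ - x₂) * (c₁ - x₁)) * a₂ + ((x₁ - a₁) * (c₂ - a₂) - (x₂ - a₂) * (c₁ - a₁)) * b₂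
        + ((b₁ - a₁) * (x₂ - a₂) - (b₂ - a₂) * (x₁ - a₁)) * c₂
    identity = solve-∀

  -- Cramer's rule multiplied by D = det a b c writes D * D * x as a combination of the vertices
  -- whose weights D * det … are exactly the quantities InT requires to be nonnegative.
  InT⇒within : ∀ (π : Point → ℤ) T x → InT T x →
    det (v₁ T) (v₂ T) (v₃ T) * π x ≡ det x (v₂ T) (v₃ T) * π (v₁ T) + det (v₁ T) x (v₃ T) * π (v₂ T) + det (v₁ T) (v₂ T) x * π (v₃ T) →
    π (v₁ T) ⊓ π (v₂ T) ⊓ π (v₃ T) ≤ π x × π x ≤ π (v₁ T) ⊔ π (v₂ T) ⊔ π (v₃ T)
  InT⇒within π (triangle a b c nd) x (0≤u₁ , 0≤u₂ , 0≤u₃) cramer =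
    weighted-mean-lower-bound 0<DD 0≤u₁ 0≤u₂ 0≤u₃ DD≡ DDx≡
      (ℤP.≤-trans (ℤP.i⊓j≤i (pa ⊓ pb) pc) (ℤP.i⊓j≤i pa pb))
      (ℤP.≤-trans (ℤP.i⊓j≤i (pa ⊓ pb) pc) (ℤP.i⊓j≤j pa pb))
      (ℤP.i⊓j≤j (pa ⊓ pb) pc) ,
    weighted-mean-upper-bound 0<DD 0≤u₁ 0≤u₂ 0≤u₃ DD≡ DDx≡
      (ℤP.≤-trans (ℤP.i≤i⊔j pa pb) (ℤP.i≤i⊔j (pa ⊔ pb) pc))
      (ℤP.≤-trans (ℤP.i≤j⊔i pa pb) (ℤP.i≤i⊔j (pa ⊔ pb) pc))
      (ℤP.i≤j⊔i (pa ⊔ pb) pc)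
    where
    pa = π a
    pb = π b
    pc = π c
    D = det a b c
    0<DD : 0ℤ < D * D
    0<DD = i≢0⇒0<i*i D nd
    scale : ∀ D w₁ w₂ w₃ → D * (w₁ + w₂ + w₃) ≡ D * w₁ + D * w₂ + D * w₃
    scale = solve-∀
    scale-weighted : ∀ D y w₁ w₂ w₃ p q r → D * (D * y) ≡ D * (w₁ * p + w₂ * q + w₃ * r) →
      D * D * y ≡ D * w₁ * p + D * w₂ * q + D * w₃ * r
    scale-weighted D y w₁ w₂ w₃ p q r e = trans (assocˡ D y) (trans e (distrib D w₁ w₂ w₃ p q r))
      where
      assocˡ : ∀ D y → D * D * y ≡ D * (D * y)
      assocˡ = solve-∀
      distrib : ∀ D w₁ w₂ w₃ p q r → D * (w₁ * p + w₂ * q + w₃ * r) ≡ D * w₁ * p + D * w₂ * q + D * w₃ * r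
      distrib = solve-∀
    DD≡ : D * D ≡ D * det x b c + D * det a x c + D * det a b x
    DD≡ = trans (cong (λ t → D * t) (sym (det-cramer-sum a b c x))) (scale D _ _ _)
    DDx≡ : D * D * π x ≡ D * det x b c * pa + D * det a x c * pb + D * det a b x * pc
    DDx≡ = scale-weighted D (π x) _ _ _ pa pb pc (cong (λ t → D * t) cramer)

  ∈-range : ∀ lo hi x → lo ≤ x → x ≤ hi → x ∈ range lo hi
  ∈-range lo hi x lo≤x x≤hi = subst (_∈ range lo hi) lo+k≡x (∈-map⁺ (λ k → lo + + k) (∈-upTo⁺ (ℕ.s≤s k≤n)))
    where
    k = ∣ x - lo ∣
    +k≡x-lo : + k ≡ x - lo
    +k≡x-lo = ℤP.0≤i⇒+∣i∣≡i (ℤP.i≤j⇒0≤j-i lo≤x)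
    lo+k≡x : lo + + k ≡ x
    lo+k≡x = trans (cong (λ t → lo + t) +k≡x-lo) (cancel lo x)
      where
      cancel : ∀ a c → a + (c - a) ≡ c
      cancel = solve-∀
    k≤n : k ℕ.≤ ∣ hi - lo ∣
    k≤n = ℤP.drop‿+≤+ (subst₂ _≤_ (sym +k≡x-lo) (sym (ℤP.0≤i⇒+∣i∣≡i (ℤP.i≤j⇒0≤j-i (ℤP.≤-trans lo≤x x≤hi))))
      (ℤP.+-monoˡ-≤ (- lo) x≤hi))

  range-unique : ∀ lo hi → Unique (range lo hi)
  range-unique lo hi = Unique.map⁺ lo+-injective (Unique.upTo⁺ _)
    where
    lo+-injective : ∀ {k k′} → lo + + k ≡ lo + + k′ → k ≡ k′
    lo+-injective {k} {k′} e = ℤP.+-injective (trans (sym (cancel lo (+ k))) (trans (cong (_- lo) e) (cancel lo (+ k′))))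
      where
      cancel : ∀ a c → (a + c) - a ≡ c
      cancel = solve-∀

  boxPoints-unique : ∀ T → Unique (boxPoints T)
  boxPoints-unique (triangle (x₁ , y₁) (x₂ , y₂) (x₃ , y₃) _) =
    Unique.cartesianProduct⁺ (range-unique (x₁ ⊓ x₂ ⊓ x₃) (x₁ ⊔ x₂ ⊔ x₃)) (range-unique (y₁ ⊓ y₂ ⊓ y₃) (y₁ ⊔ y₂ ⊔ y₃))

  InT⇒∈boxPoints : ∀ T x → InT T x → x ∈ boxPoints T
  InT⇒∈boxPoints T@(triangle a b c _) x x∈T =
    ∈-cartesianProduct⁺ (∈-range _ _ _ (proj₁ bounds₁) (proj₂ bounds₁)) (∈-range _ _ _ (proj₁ bounds₂) (proj₂ bounds₂))
    where
    bounds₁ = InT⇒within proj₁ T x x∈T (det-cramer₁ a b c x)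
    bounds₂ = InT⇒within proj₂ T x x∈T (det-cramer₂ a b c x)

  record PointCorrespondence (T T′ : LatticeTriangle) : Set where
    field
      to from : Point → Point
      to-from : ∀ y → to (from y) ≡ y
      from-to : ∀ x → from (to x) ≡ x
      InT-to : ∀ x → InT T′ (to x) ⇔ InT T x
      InInterior-to : ∀ x → InInterior T′ (to x) ⇔ InInterior T x

  record SameCounts (T T′ : LatticeTriangle) : Set where
    constructor sameCounts
    field
      b≡ : b T ≡ b T′
      i≡ : i T ≡ i T′

  SameCounts-trans : ∀ {T T′ T″} → SameCounts T T′ → SameCounts T′ T″ → SameCounts T T″
  SameCounts-trans (sameCounts b≡ i≡) (sameCounts b≡′ i≡′) = sameCounts (trans b≡ b≡′) (trans i≡ i≡′)

  InInterior⇒InT : ∀ T x → InInterior T x → InT T x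
  InInterior⇒InT T x (p , q , r) = ℤP.<⇒≤ p , ℤP.<⇒≤ q , ℤP.<⇒≤ r

  module _ {T T′ : LatticeTriangle} (C : PointCorrespondence T T′) where
    open PointCorrespondence C

    private
      count-preserved : {P P′ : Point → Set} (P? : Decidable P) (P′? : Decidable P′) →
        (∀ x → P x → InT T x) → (∀ y → P′ y → InT T′ y) → (∀ x → P′ (to x) ⇔ P x) →
        length (filter P? (boxPoints T)) ≡ length (filter P′? (boxPoints T′))
      count-preserved {P} {P′} P? P′? P⊆T P′⊆T′ P′∘to⇔P =
        sym (trans (unique∧set⇒length≡ (Unique.filter⁺ P′? (boxPoints-unique T′))
                                        (Unique.map⁺ to-injective (Unique.filter⁺ P? (boxPoints-unique T)))
                                        (mk⇔ forth back))
                   (length-map to (filter P? (boxPoints T))))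
        where
        to-injective : ∀ {x x′} → to x ≡ to x′ → x ≡ x′
        to-injective {x} {x′} e = trans (sym (from-to x)) (trans (cong from e) (from-to x′))
        forth : ∀ {y} → y ∈ filter P′? (boxPoints T′) → y ∈ map to (filter P? (boxPoints T))
        forth {y} y∈ = subst (_∈ map to (filter P? (boxPoints T))) (to-from y)
          (∈-map⁺ to (∈-filter⁺ P? (InT⇒∈boxPoints T (from y) (P⊆T (from y) Pfy)) Pfy))
          where
          Pfy : P (from y)
          Pfy = Equivalence.to (P′∘to⇔P (from y)) (subst P′ (sym (to-from y)) (proj₂ (∈-filter⁻ P′? y∈)))
        back : ∀ {y} → y ∈ map to (filter P? (boxPoints T)) → y ∈ filter P′? (boxPoints T′)
        back y∈ with ∈-map⁻ to y∈
        ... | x , x∈ , refl = ∈-filter⁺ P′? (InT⇒∈boxPoints T′ (to x) (P′⊆T′ (to x) P′tx)) P′tx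
          where
          P′tx = Equivalence.from (P′∘to⇔P x) (proj₂ (∈-filter⁻ P? x∈))

    counts-preserved : SameCounts T T′
    counts-preserved = sameCounts
      (count-preserved (onBoundary? T) (onBoundary? T′) (λ _ → proj₁) (λ _ → proj₁) OnBoundary-to)
      (count-preserved (inInterior? T) (inInterior? T′) (InInterior⇒InT T) (InInterior⇒InT T′) InInterior-to)
      where
      OnBoundary-to : ∀ x → OnBoundary T′ (to x) ⇔ OnBoundary T x
      OnBoundary-to x = mk⇔ (λ (p , q) → Equivalence.to (InT-to x) p , λ r → q (Equivalence.from (InInterior-to x) r))
                            (λ (p , q) → Equivalence.from (InT-to x) p , λ r → q (Equivalence.to (InInterior-to x) r))

module Symmetries where

  open import Defs
  open Counting
  open import Data.Nat using (ℕ)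
  open import Data.Nat.Divisibility using (_∣_; ∣-antisym)
  open import Data.Nat.GCD using (gcd; gcd[m,n]∣m; gcd[m,n]∣n; gcd-greatest)
  open import Data.Integer as ℤ using (ℤ; +_; _+_; _-_; _*_; -_; _≤_; _<_; ∣_∣; 0ℤ; 1ℤ)
  import Data.Integer.Divisibility.Signed as ℤ∣
  import Data.Integer.Properties as ℤP
  open import Data.Integer.Tactic.RingSolver
  open import Data.Product using (_×_; _,_)
  open import Relation.Nullary using (¬_)
  open import Relation.Binary.PropositionalEquality
  open import Function.Base using (id)
  open import Function.Bundles using (_⇔_; mk⇔)
  import Function.Properties.Equivalence as ⇔

  triple-cong : (R : ℤ → Set) {a b c a′ b′ c′ : ℤ} → a′ ≡ a → b′ ≡ b → c′ ≡ c →
    (R a′ × R b′ × R c′) ⇔ (R a × R b × R c)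
  triple-cong R refl refl refl = mk⇔ id id

  triple-rotate : {A B C : Set} → (B × C × A) ⇔ (A × B × C)
  triple-rotate = mk⇔ (λ (b , c , a) → a , b , c) (λ (a , b , c) → b , c , a)

  SameCounts-vertices : ∀ {p q r p′ q′ r′} (nd : ¬ det p q r ≡ 0ℤ) (nd′ : ¬ det p′ q′ r′ ≡ 0ℤ) →
    p ≡ p′ → q ≡ q′ → r ≡ r′ → SameCounts (triangle p q r nd) (triangle p′ q′ r′ nd′)
  SameCounts-vertices _ _ refl refl refl = sameCounts refl refl

  det-rotate : ∀ p q r → det p q r ≡ det q r p
  det-rotate (a₁ , a₂) (b₁ , b₂) (c₁ , c₂) = identity a₁ a₂ b₁ b₂ c₁ c₂
    where
    identity : ∀ a₁ a₂ b₁ b₂ c₁ c₂ →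
      (b₁ - a₁) * (c₂ - a₂) - (b₂ - a₂) * (c₁ - a₁) ≡ (c₁ - b₁) * (a₂ - b₂) - (c₂ - b₂) * (a₁ - b₁)
    identity = solve-∀

  rotate : LatticeTriangle → LatticeTriangle
  rotate (triangle p q r nd) = triangle q r p (λ e → nd (trans (det-rotate p q r) e))

  rotate-SameCounts : ∀ T → SameCounts T (rotate T)
  rotate-SameCounts T@(triangle p q r nd) = counts-preserved {T} {rotate T} (record
    { to = id ; from = id ; to-from = λ _ → refl ; from-to = λ _ → refl
    ; InT-to = λ x → weights-rotate (0ℤ ≤_) x
    ; InInterior-to = λ x → weights-rotate (0ℤ <_) x })
    where
    D′≡D : det q r p ≡ det p q r
    D′≡D = sym (det-rotate p q r)
    weights-rotate : ∀ (R : ℤ → Set) x →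
      (R (det q r p * det x r p) × R (det q r p * det q x p) × R (det q r p * det q r x)) ⇔
      (R (det p q r * det x q r) × R (det p q r * det p x r) × R (det p q r * det p q x))
    weights-rotate R x = ⇔.trans
      (triple-cong R (cong₂ _*_ D′≡D (sym (det-rotate p x r))) (cong₂ _*_ D′≡D (sym (det-rotate p q x)))
                     (cong₂ _*_ D′≡D (sym (det-rotate x q r))))
      triple-rotate

  record Matrix : Set where
    constructor matrix
    field
      m₁₁ m₁₂ m₂₁ m₂₂ : ℤ

  det₂ : Matrix → ℤ
  det₂ (matrix a b c d) = a * d - b * c

  apply : Matrix → Point → Point
  apply (matrix a b c d) (x , y) = a * x + b * y , c * x + d * y

  -- δ · adj M, which is M⁻¹ as soon as δ = det₂ M is a unit.
  inverse : Matrix → Matrix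
  inverse M@(matrix a b c d) = matrix (δ * d) (δ * - b) (δ * - c) (δ * a)
    where δ = det₂ M

  _-ₚ_ : Point → Point → Point
  (x , y) -ₚ (u , v) = x - u , y - v

  _+ₚ_ : Point → Point → Point
  (x , y) +ₚ (u , v) = x + u , y + v

  content : Point → ℕ
  content (x , y) = gcd ∣ x ∣ ∣ y ∣

  edgeLength : Point → Point → ℕ
  edgeLength p q = content (q -ₚ p)

  content∣content-apply : ∀ M z → content z ∣ content (apply M z)
  content∣content-apply (matrix a b c d) (z₁ , z₂) =
    gcd-greatest (∣-combination a b) (∣-combination c d)
    where
    g = content (z₁ , z₂)
    ∣z₁ = ℤ∣.∣ᵤ⇒∣ {+ g} {z₁} (gcd[m,n]∣m ∣ z₁ ∣ ∣ z₂ ∣)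
    ∣z₂ = ℤ∣.∣ᵤ⇒∣ {+ g} {z₂} (gcd[m,n]∣n ∣ z₁ ∣ ∣ z₂ ∣)
    ∣-combination : ∀ s t → g ∣ ∣ s * z₁ + t * z₂ ∣
    ∣-combination s t = ℤ∣.∣⇒∣ᵤ {+ g} (ℤ∣.∣m∣n⇒∣m+n (ℤ∣.∣n⇒∣m*n s ∣z₁) (ℤ∣.∣n⇒∣m*n t ∣z₂))

  module Unimodular (a b c d : ℤ) (det²≡1 : (a * d - b * c) * (a * d - b * c) ≡ 1ℤ) where

    M : Matrix
    M = matrix a b c d
    δ : ℤ
    δ = det₂ M

    δδ-cancel : ∀ x → δ * δ * x ≡ x
    δδ-cancel x = trans (cong (_* x) det²≡1) (ℤP.*-identityˡ x)

    inverse-apply : ∀ x → apply (inverse M) (apply M x) ≡ x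
    inverse-apply (x , y) = cong₂ _,_ (trans (first a b c d x y) (δδ-cancel x)) (trans (second a b c d x y) (δδ-cancel y))
      where
      first : ∀ a b c d x y → (a * d - b * c) * d * (a * x + b * y) + (a * d - b * c) * - b * (c * x + d * y)
                              ≡ (a * d - b * c) * (a * d - b * c) * x
      first = solve-∀
      second : ∀ a b c d x y → (a * d - b * c) * - c * (a * x + b * y) + (a * d - b * c) * a * (c * x + d * y)
                               ≡ (a * d - b * c) * (a * d - b * c) * y
      second = solve-∀

    apply-inverse : ∀ y → apply M (apply (inverse M) y) ≡ y
    apply-inverse (x , y) = cong₂ _,_ (trans (first a b c d x y) (δδ-cancel x)) (trans (second a b c d x y) (δδ-cancel y))
      where
      first : ∀ a b c d x y → a * ((a * d - b * c) * d * x + (a * d - b * c) * - b * y) + b * ((a * d - b * c) * - c * x + (a * d - b * c) * a * y)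
                              ≡ (a * d - b * c) * (a * d - b * c) * x
      first = solve-∀
      second : ∀ a b c d x y → c * ((a * d - b * c) * d * x + (a * d - b * c) * - b * y) + d * ((a * d - b * c) * - c * x + (a * d - b * c) * a * y)
                               ≡ (a * d - b * c) * (a * d - b * c) * y
      second = solve-∀

    content-apply : ∀ z → content (apply M z) ≡ content z
    content-apply z = ∣-antisym
      (subst (λ w → content (apply M z) ∣ content w) (inverse-apply z) (content∣content-apply (inverse M) (apply M z)))
      (content∣content-apply M z)

    module Affine (u₁ u₂ : ℤ) where

      u : Point
      u = u₁ , u₂

      to : Point → Point
      to x = apply M (x -ₚ u)

      from : Point → Point
      from y = apply (inverse M) y +ₚ u

      to-from : ∀ y → to (from y) ≡ y
      to-from y = trans (cong (apply M) (+ₚ-cancel (apply (inverse M) y))) (apply-inverse y)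
        where
        +ₚ-cancel : ∀ w → (w +ₚ u) -ₚ u ≡ w
        +ₚ-cancel (w₁ , w₂) = cong₂ _,_ (cancel w₁ u₁) (cancel w₂ u₂)
          where
          cancel : ∀ w u → w + u - u ≡ w
          cancel = solve-∀

      from-to : ∀ x → from (to x) ≡ x
      from-to x = trans (cong (_+ₚ u) (inverse-apply (x -ₚ u))) (-ₚ-cancel x)
        where
        -ₚ-cancel : ∀ x → (x -ₚ u) +ₚ u ≡ x
        -ₚ-cancel (x₁ , x₂) = cong₂ _,_ (cancel x₁ u₁) (cancel x₂ u₂)
          where
          cancel : ∀ x u → x - u + u ≡ x
          cancel = solve-∀

      det-to : ∀ x y z → det (to x) (to y) (to z) ≡ δ * det x y z
      det-to (x₁ , x₂) (y₁ , y₂) (z₁ , z₂) = identity a b c d x₁ x₂ y₁ y₂ z₁ z₂ u₁ u₂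
        where
        identity : ∀ a b c d x₁ x₂ y₁ y₂ z₁ z₂ u₁ u₂ →
          let X₁ = a * (x₁ - u₁) + b * (x₂ - u₂) ; X₂ = c * (x₁ - u₁) + d * (x₂ - u₂)
              Y₁ = a * (y₁ - u₁) + b * (y₂ - u₂) ; Y₂ = c * (y₁ - u₁) + d * (y₂ - u₂)
              Z₁ = a * (z₁ - u₁) + b * (z₂ - u₂) ; Z₂ = c * (z₁ - u₁) + d * (z₂ - u₂) in
          (Y₁ - X₁) * (Z₂ - X₂) - (Y₂ - X₂) * (Z₁ - X₁) ≡ (a * d - b * c) * ((y₁ - x₁) * (z₂ - x₂) - (y₂ - x₂) * (z₁ - x₁))
        identity = solve-∀

      det-to-product : ∀ x y z x′ y′ z′ → det (to x) (to y) (to z) * det (to x′) (to y′) (to z′) ≡ det x y z * det x′ y′ z′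
      det-to-product x y z x′ y′ z′ = begin
        det (to x) (to y) (to z) * det (to x′) (to y′) (to z′) ≡⟨ cong₂ _*_ (det-to x y z) (det-to x′ y′ z′) ⟩
        δ * det x y z * (δ * det x′ y′ z′)                     ≡⟨ regroup δ (det x y z) (det x′ y′ z′) ⟩
        δ * δ * (det x y z * det x′ y′ z′)                     ≡⟨ δδ-cancel _ ⟩
        det x y z * det x′ y′ z′                               ∎
        where
        open ≡-Reasoning
        regroup : ∀ t D E → t * D * (t * E) ≡ t * t * (D * E)
        regroup = solve-∀

      edgeLength-to : ∀ p q → edgeLength (to p) (to q) ≡ edgeLength p q
      edgeLength-to p q = trans (cong content (to-difference p q)) (content-apply (q -ₚ p))
        where
        to-difference : ∀ p q → to q -ₚ to p ≡ apply M (q -ₚ p)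
        to-difference (p₁ , p₂) (q₁ , q₂) = cong₂ _,_ (identity a b p₁ p₂ q₁ q₂ u₁ u₂) (identity c d p₁ p₂ q₁ q₂ u₁ u₂)
          where
          identity : ∀ a b p₁ p₂ q₁ q₂ u₁ u₂ →
            a * (q₁ - u₁) + b * (q₂ - u₂) - (a * (p₁ - u₁) + b * (p₂ - u₂)) ≡ a * (q₁ - p₁) + b * (q₂ - p₂)
          identity = solve-∀

      image : LatticeTriangle → LatticeTriangle
      image (triangle p q r nd) = triangle (to p) (to q) (to r) λ e → nd (begin
        det p q r             ≡⟨ δδ-cancel (det p q r) ⟨
        δ * δ * det p q r     ≡⟨ ℤP.*-assoc δ δ (det p q r) ⟩
        δ * (δ * det p q r)   ≡⟨ cong (δ *_) (trans (sym (det-to p q r)) e) ⟩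
        δ * 0ℤ                ≡⟨ ℤP.*-zeroʳ δ ⟩
        0ℤ                    ∎)
        where open ≡-Reasoning

      image-SameCounts : ∀ T → SameCounts T (image T)
      image-SameCounts T@(triangle p q r nd) = counts-preserved {T} {image T} (record
        { to = to ; from = from ; to-from = to-from ; from-to = from-to
        ; InT-to = λ x → weights-to (0ℤ ≤_) x
        ; InInterior-to = λ x → weights-to (0ℤ <_) x })
        where
        weights-to : ∀ (R : ℤ → Set) x →
          (R (det (to p) (to q) (to r) * det (to x) (to q) (to r)) × R (det (to p) (to q) (to r) * det (to p) (to x) (to r))
            × R (det (to p) (to q) (to r) * det (to p) (to q) (to x))) ⇔
          (R (det p q r * det x q r) × R (det p q r * det p x r) × R (det p q r * det p q x))
        weights-to R x = triple-cong R (det-to-product p q r x q r) (det-to-product p q r p x r) (det-to-product p q r p q x)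

module NormalForm where

  open import Defs
  open Counting
  open Symmetries
  open import Data.Nat as ℕ using (ℕ; suc; NonZero)
  open import Data.Nat.GCD using (gcd; gcd-GCD; gcd[m,n]∣m; gcd[m,n]∣n; gcd[m,n]≡0⇒m≡0; gcd[m,n]≡0⇒n≡0; module Bézout)
  open import Data.Integer as ℤ using (ℤ; +_; -[1+_]; _+_; _-_; _*_; -_; _≤_; ∣_∣; 0ℤ; 1ℤ; +≤+)
  import Data.Integer.Properties as ℤP
  import Data.Integer.Divisibility.Signed as ℤ∣
  open import Data.Integer.Tactic.RingSolver
  open import Data.Product using (_×_; _,_; proj₁; proj₂; Σ; ∃₂)
  open import Relation.Nullary using (¬_)
  open import Relation.Binary.PropositionalEquality

  standard-nondegenerate : ∀ e h r .{{_ : NonZero e}} .{{_ : NonZero h}} →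
    ¬ det (+ 0 , + 0) (+ 0 , + e) (+ h , + (e ℕ.+ r)) ≡ 0ℤ
  standard-nondegenerate (suc _) (suc _) r ()

  standard : (e h r : ℕ) .{{_ : NonZero e}} .{{_ : NonZero h}} → LatticeTriangle
  standard e h r = triangle (+ 0 , + 0) (+ 0 , + e) (+ h , + (e ℕ.+ r)) (standard-nondegenerate e h r)

  module _ (e h r : ℕ) .{{_ : NonZero e}} .{{_ : NonZero h}} where

    private
      N = standard e h r
      D = det (v₁ N) (v₂ N) (v₃ N)

    standard-weight₁ : ∀ k j → D * det (+ k , + j) (v₂ N) (v₃ N) ≡ + (e ℕ.* h) * (+ (e ℕ.* h ℕ.+ k ℕ.* r) - + (j ℕ.* h))
    standard-weight₁ k j = trans (identity (+ e) (+ h) (+ k) (+ j) (+ r))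
      (cong₂ _*_ (sym (ℤP.pos-* e h)) (cong₂ _-_ (cong₂ _+_ (sym (ℤP.pos-* e h)) (sym (ℤP.pos-* k r))) (sym (ℤP.pos-* j h))))
      where
      identity : ∀ E H K J R → ((+ 0 - + 0) * ((E + R) - + 0) - (E - + 0) * (H - + 0)) * ((+ 0 - K) * ((E + R) - J) - (E - J) * (H - K))
                               ≡ E * H * (E * H + K * R - J * H)
      identity = solve-∀

    standard-weight₂ : ∀ k j → D * det (v₁ N) (+ k , + j) (v₃ N) ≡ + (e ℕ.* h) * (+ (j ℕ.* h) - + (k ℕ.* (e ℕ.+ r)))
    standard-weight₂ k j = trans (identity (+ e) (+ h) (+ k) (+ j) (+ r))
      (cong₂ _*_ (sym (ℤP.pos-* e h)) (cong₂ _-_ (sym (ℤP.pos-* j h)) (sym (ℤP.pos-* k (e ℕ.+ r)))))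
      where
      identity : ∀ E H K J R → ((+ 0 - + 0) * ((E + R) - + 0) - (E - + 0) * (H - + 0)) * ((K - + 0) * ((E + R) - + 0) - (J - + 0) * (H - + 0))
                               ≡ E * H * (J * H - K * (E + R))
      identity = solve-∀

    standard-weight₃ : ∀ k j → D * det (v₁ N) (v₂ N) (+ k , + j) ≡ + (e ℕ.* h) * (+ (e ℕ.* k) - + 0)
    standard-weight₃ k j = trans (identity (+ e) (+ h) (+ k) (+ j) (+ r))
      (cong₂ _*_ (sym (ℤP.pos-* e h)) (cong (_- + 0) (sym (ℤP.pos-* e k))))
      where
      identity : ∀ E H K J R → ((+ 0 - + 0) * ((E + R) - + 0) - (E - + 0) * (H - + 0)) * ((+ 0 - + 0) * (J - + 0) - (E - + 0) * (K - + 0))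
                               ≡ E * H * (E * K - + 0)
      identity = solve-∀

  record StandardForm (T : LatticeTriangle) : Set where
    field
      e h r : ℕ
      e-nonZero : NonZero e
      h-nonZero : NonZero h
      counts : SameCounts T (standard e h r {{e-nonZero}} {{h-nonZero}})
      edge₁₂ : edgeLength (v₁ T) (v₂ T) ≡ e
      edge₁₃ : edgeLength (v₁ T) (v₃ T) ≡ gcd h (e ℕ.+ r)
      edge₂₃ : edgeLength (v₂ T) (v₃ T) ≡ gcd h r

  ∣∣-unit-multiple : ∀ z → Σ ℤ λ σ → + ∣ z ∣ ≡ σ * z × σ * σ ≡ 1ℤ
  ∣∣-unit-multiple (+ n) = + 1 , sym (ℤP.*-identityˡ (+ n)) , refl
  ∣∣-unit-multiple -[1+ n ] = ℤ.-1ℤ , sym (ℤP.-1*i≡-i -[1+ n ]) , refl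

  bezout-lift : ∀ {d m n zm zn σm σn} x y → d ℕ.+ y ℕ.* n ≡ x ℕ.* m → + m ≡ σm * zm → + n ≡ σn * zn →
    + x * σm * zm + - (+ y * σn) * zn ≡ + d
  bezout-lift {d} {m} {n} {zm} {zn} {σm} {σn} x y eq m≡ n≡ = begin
    + x * σm * zm + - (+ y * σn) * zn     ≡⟨ regroup (+ x) (+ y) σm σn zm zn ⟩
    + x * (σm * zm) - + y * (σn * zn)     ≡⟨ cong₂ (λ a c → + x * a - + y * c) m≡ n≡ ⟨
    + x * + m - + y * + n                 ≡⟨ cong₂ _-_ (ℤP.pos-* x m) (ℤP.pos-* y n) ⟨
    + (x ℕ.* m) - + (y ℕ.* n)             ≡⟨ cong (_- + (y ℕ.* n)) (trans (sym (ℤP.pos-+ d (y ℕ.* n))) (cong +_ eq)) ⟨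
    + d + + (y ℕ.* n) - + (y ℕ.* n)       ≡⟨ cancel (+ d) (+ (y ℕ.* n)) ⟩
    + d                                   ∎
    where
    open ≡-Reasoning
    regroup : ∀ X Y σm σn zm zn → X * σm * zm + - (Y * σn) * zn ≡ X * (σm * zm) - Y * (σn * zn)
    regroup = solve-∀
    cancel : ∀ D W → D + W - W ≡ D
    cancel = solve-∀

  bezout : ∀ z₁ z₂ → ∃₂ λ s t → s * z₁ + t * z₂ ≡ + content (z₁ , z₂)
  bezout z₁ z₂ with ∣∣-unit-multiple z₁ | ∣∣-unit-multiple z₂ | Bézout.identity (gcd-GCD ∣ z₁ ∣ ∣ z₂ ∣)
  ... | σ₁ , ∣z₁∣≡ , _ | σ₂ , ∣z₂∣≡ , _ | Bézout.+- x y eq =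
    + x * σ₁ , - (+ y * σ₂) , bezout-lift x y eq ∣z₁∣≡ ∣z₂∣≡
  ... | σ₁ , ∣z₁∣≡ , _ | σ₂ , ∣z₂∣≡ , _ | Bézout.-+ x y eq =
    - (+ x * σ₁) , + y * σ₂ , trans (swap (+ x * σ₁) (+ y * σ₂) z₁ z₂) (bezout-lift y x eq ∣z₂∣≡ ∣z₁∣≡)
    where
    swap : ∀ a c z₁ z₂ → - a * z₁ + c * z₂ ≡ c * z₂ + - a * z₁
    swap = solve-∀

  edgeLength-standard₁₃ : ∀ x y → edgeLength (+ 0 , + 0) (+ x , + y) ≡ gcd x y
  edgeLength-standard₁₃ x y = cong₂ gcd (∣+n-0∣ x) (∣+n-0∣ y)
    where
    ∣+n-0∣ : ∀ n → ∣ + n - + 0 ∣ ≡ n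
    ∣+n-0∣ n = cong ∣_∣ (ℤP.+-identityʳ (+ n))

  edgeLength-standard₂₃ : ∀ e h r → edgeLength (+ 0 , + e) (+ h , + (e ℕ.+ r)) ≡ gcd h r
  edgeLength-standard₂₃ e h r = cong₂ gcd (cong ∣_∣ (ℤP.+-identityʳ (+ h))) (cong ∣_∣ (cancel e r))
    where
    cancel : ∀ e r → + (e ℕ.+ r) - + e ≡ + r
    cancel e r = trans (cong (_- + e) (ℤP.pos-+ e r)) (identity (+ e) (+ r))
      where
      identity : ∀ E R → E + R - E ≡ R
      identity = solve-∀

  -- The unimodular map sends A to the origin and the primitive direction (p₁ , p₂) of AB to
  -- (0 , 1); its first row is ±(-p₂ , p₁), and a multiple m of it is added to the Bézout row
  -- (s , t) to push C above B.
  module Construction (a₁ a₂ b₁ b₂ c₁ c₂ : ℤ) (nd : ¬ det (a₁ , a₂) (b₁ , b₂) (c₁ , c₂) ≡ 0ℤ) (p₁ p₂ s t : ℤ)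
    (u₁≡ : b₁ - a₁ ≡ p₁ * + edgeLength (a₁ , a₂) (b₁ , b₂)) (u₂≡ : b₂ - a₂ ≡ p₂ * + edgeLength (a₁ , a₂) (b₁ , b₂))
    (bezout-u : s * (b₁ - a₁) + t * (b₂ - a₂) ≡ + edgeLength (a₁ , a₂) (b₁ , b₂)) where

    T : LatticeTriangle
    T = triangle (a₁ , a₂) (b₁ , b₂) (c₁ , c₂) nd

    u₁ u₂ w₁ w₂ h₀ : ℤ
    u₁ = b₁ - a₁
    u₂ = b₂ - a₂
    w₁ = c₁ - a₁
    w₂ = c₂ - a₂
    h₀ = p₁ * w₂ - p₂ * w₁

    e : ℕ
    e = edgeLength (a₁ , a₂) (b₁ , b₂)

    det≡e*h₀ : det (a₁ , a₂) (b₁ , b₂) (c₁ , c₂) ≡ + e * h₀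
    det≡e*h₀ = trans (cong₂ (λ x y → x * w₂ - y * w₁) u₁≡ u₂≡) (factor p₁ p₂ (+ e) w₁ w₂)
      where
      factor : ∀ p₁ p₂ E w₁ w₂ → p₁ * E * w₂ - p₂ * E * w₁ ≡ E * (p₁ * w₂ - p₂ * w₁)
      factor = solve-∀

    e≢0 : ¬ e ≡ 0
    e≢0 e≡0 = nd (trans (cong₂ (λ x y → x * w₂ - y * w₁) u₁≡0 u₂≡0) (vanish w₁ w₂))
      where
      u₁≡0 : u₁ ≡ + 0
      u₁≡0 = ℤP.∣i∣≡0⇒i≡0 (gcd[m,n]≡0⇒m≡0 {∣ u₁ ∣} {∣ u₂ ∣} e≡0)
      u₂≡0 : u₂ ≡ + 0
      u₂≡0 = ℤP.∣i∣≡0⇒i≡0 (gcd[m,n]≡0⇒n≡0 ∣ u₁ ∣ {∣ u₂ ∣} e≡0)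
      vanish : ∀ w₁ w₂ → + 0 * w₂ - + 0 * w₁ ≡ 0ℤ
      vanish = solve-∀

    h : ℕ
    h = ∣ h₀ ∣

    h≢0 : ¬ h ≡ 0
    h≢0 h≡0 = nd (trans det≡e*h₀ (trans (cong (λ x → + e * x) (ℤP.∣i∣≡0⇒i≡0 h≡0)) (ℤP.*-zeroʳ (+ e))))

    instance
      e-nonZero : NonZero e
      e-nonZero = ℕ.≢-nonZero e≢0
      h-nonZero : NonZero h
      h-nonZero = ℕ.≢-nonZero h≢0

    ε : ℤ
    ε = proj₁ (∣∣-unit-multiple h₀)
    +h≡ε*h₀ : + h ≡ ε * h₀
    +h≡ε*h₀ = proj₁ (proj₂ (∣∣-unit-multiple h₀))
    ε*ε≡1 : ε * ε ≡ 1ℤ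
    ε*ε≡1 = proj₂ (proj₂ (∣∣-unit-multiple h₀))

    bezout-p : s * p₁ + t * p₂ ≡ 1ℤ
    bezout-p = ℤP.*-cancelʳ-≡ (s * p₁ + t * p₂) 1ℤ (+ e) {{ℤ.≢-nonZero (λ z → e≢0 (ℤP.+-injective z))}} (begin
      (s * p₁ + t * p₂) * + e         ≡⟨ distrib s t p₁ p₂ (+ e) ⟩
      s * (p₁ * + e) + t * (p₂ * + e) ≡⟨ cong₂ (λ x y → s * x + t * y) u₁≡ u₂≡ ⟨
      s * u₁ + t * u₂                 ≡⟨ bezout-u ⟩
      + e                             ≡⟨ ℤP.*-identityˡ (+ e) ⟨
      1ℤ * + e                        ∎)
      where
      open ≡-Reasoning
      distrib : ∀ s t p₁ p₂ E → (s * p₁ + t * p₂) * E ≡ s * (p₁ * E) + t * (p₂ * E)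
      distrib = solve-∀

    q₀ : ℤ
    q₀ = s * w₁ + t * w₂
    m : ℤ
    m = + (∣ q₀ ∣ ℕ.+ e)

    m₁₁ m₁₂ m₂₁ m₂₂ : ℤ
    m₁₁ = ε * - p₂
    m₁₂ = ε * p₁
    m₂₁ = s + m * (ε * - p₂)
    m₂₂ = t + m * (ε * p₁)

    det²≡1 : (m₁₁ * m₂₂ - m₁₂ * m₂₁) * (m₁₁ * m₂₂ - m₁₂ * m₂₁) ≡ 1ℤ
    det²≡1 = begin
      (m₁₁ * m₂₂ - m₁₂ * m₂₁) * (m₁₁ * m₂₂ - m₁₂ * m₂₁)  ≡⟨ expand ε s t p₁ p₂ m ⟩
      ε * ε * ((s * p₁ + t * p₂) * (s * p₁ + t * p₂))    ≡⟨ cong (λ x → ε * ε * (x * x)) bezout-p ⟩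
      ε * ε * 1ℤ                                         ≡⟨ trans (ℤP.*-identityʳ (ε * ε)) ε*ε≡1 ⟩
      1ℤ                                                 ∎
      where
      open ≡-Reasoning
      expand : ∀ ε s t p₁ p₂ m →
        (ε * - p₂ * (t + m * (ε * p₁)) - ε * p₁ * (s + m * (ε * - p₂))) * (ε * - p₂ * (t + m * (ε * p₁)) - ε * p₁ * (s + m * (ε * - p₂)))
        ≡ ε * ε * ((s * p₁ + t * p₂) * (s * p₁ + t * p₂))
      expand = solve-∀

    open Unimodular m₁₁ m₁₂ m₂₁ m₂₂ det²≡1
    open Affine a₁ a₂

    -- C lands at height q₀ + m h, and the choice of m makes this at least e.
    e≤height : 0ℤ ≤ q₀ + m * + h - + e
    e≤height = subst (0ℤ ≤_) (sym (regroup q₀ (+ ∣ q₀ ∣) (+ e) (+ h)))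
      (ℤP.+-mono-≤ (q+∣q∣≥0 q₀) (0≤i⇒0≤j⇒0≤i*j {+ ∣ q₀ ∣ + + e} {+ h - + 1} (+≤+ ℕ.z≤n)
                                                  (ℤP.i≤j⇒0≤j-i (+≤+ (ℕ.>-nonZero⁻¹ h)))))
      where
      regroup : ∀ q Q E H → q + (Q + E) * H - E ≡ (q + Q) + (Q + E) * (H - + 1)
      regroup = solve-∀
      q+∣q∣≥0 : ∀ q → 0ℤ ≤ q + + ∣ q ∣
      q+∣q∣≥0 (+ n) = +≤+ ℕ.z≤n
      q+∣q∣≥0 -[1+ n ] = ℤP.≤-reflexive (sym (ℤP.+-inverseˡ (+ suc n)))

    r : ℕ
    r = ∣ q₀ + m * + h - + e ∣

    e+r≡height : + (e ℕ.+ r) ≡ q₀ + m * + h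
    e+r≡height = trans (ℤP.pos-+ e r) (trans (cong (λ x → + e + x) (ℤP.0≤i⇒+∣i∣≡i e≤height)) (cancel (+ e) (q₀ + m * + h)))
      where
      cancel : ∀ E q → E + (q - E) ≡ q
      cancel = solve-∀

    to-A : to (a₁ , a₂) ≡ (+ 0 , + 0)
    to-A = cong₂ _,_ (vanish m₁₁ m₁₂ a₁ a₂) (vanish m₂₁ m₂₂ a₁ a₂)
      where
      vanish : ∀ x y a₁ a₂ → x * (a₁ - a₁) + y * (a₂ - a₂) ≡ + 0
      vanish = solve-∀

    row₁-u : m₁₁ * u₁ + m₁₂ * u₂ ≡ + 0
    row₁-u = trans (cong₂ (λ x y → m₁₁ * x + m₁₂ * y) u₁≡ u₂≡) (vanish ε p₁ p₂ (+ e))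
      where
      vanish : ∀ ε p₁ p₂ E → ε * - p₂ * (p₁ * E) + ε * p₁ * (p₂ * E) ≡ + 0
      vanish = solve-∀

    row₂-u : m₂₁ * u₁ + m₂₂ * u₂ ≡ + e
    row₂-u = begin
      m₂₁ * u₁ + m₂₂ * u₂                 ≡⟨ cong₂ (λ x y → m₂₁ * x + m₂₂ * y) u₁≡ u₂≡ ⟩
      m₂₁ * (p₁ * + e) + m₂₂ * (p₂ * + e) ≡⟨ collect ε s t m p₁ p₂ (+ e) ⟩
      + e * (s * p₁ + t * p₂)             ≡⟨ cong (+ e *_) bezout-p ⟩
      + e * 1ℤ                            ≡⟨ ℤP.*-identityʳ (+ e) ⟩
      + e                                 ∎
      where
      open ≡-Reasoning
      collect : ∀ ε s t m p₁ p₂ E → (s + m * (ε * - p₂)) * (p₁ * E) + (t + m * (ε * p₁)) * (p₂ * E) ≡ E * (s * p₁ + t * p₂)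
      collect = solve-∀

    to-B : to (b₁ , b₂) ≡ (+ 0 , + e)
    to-B = cong₂ _,_ row₁-u row₂-u

    to-C : to (c₁ , c₂) ≡ (+ h , + (e ℕ.+ r))
    to-C = cong₂ _,_
      (trans (collect₁ ε p₁ p₂ w₁ w₂) (sym +h≡ε*h₀))
      (trans (collect₂ ε s t m p₁ p₂ w₁ w₂) (trans (cong (λ x → q₀ + m * x) (sym +h≡ε*h₀)) (sym e+r≡height)))
      where
      collect₁ : ∀ ε p₁ p₂ w₁ w₂ → ε * - p₂ * w₁ + ε * p₁ * w₂ ≡ ε * (p₁ * w₂ - p₂ * w₁)
      collect₁ = solve-∀
      collect₂ : ∀ ε s t m p₁ p₂ w₁ w₂ → (s + m * (ε * - p₂)) * w₁ + (t + m * (ε * p₁)) * w₂ ≡ (s * w₁ + t * w₂) + m * (ε * (p₁ * w₂ - p₂ * w₁))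
      collect₂ = solve-∀

    standardForm : StandardForm T
    standardForm = record
      { e = e ; h = h ; r = r ; e-nonZero = e-nonZero ; h-nonZero = h-nonZero
      ; counts = SameCounts-trans (image-SameCounts T)
                       (SameCounts-vertices (nondegenerate (image T)) (nondegenerate (standard e h r)) to-A to-B to-C)
      ; edge₁₂ = refl
      ; edge₁₃ = trans (sym (edgeLength-to (a₁ , a₂) (c₁ , c₂)))
                       (trans (cong₂ edgeLength to-A to-C) (edgeLength-standard₁₃ h (e ℕ.+ r)))
      ; edge₂₃ = trans (sym (edgeLength-to (b₁ , b₂) (c₁ , c₂)))
                       (trans (cong₂ edgeLength to-B to-C) (edgeLength-standard₂₃ e h r)) }

  content-divides : ∀ z₁ z₂ → Σ ℤ λ p₁ → Σ ℤ λ p₂ → z₁ ≡ p₁ * + content (z₁ , z₂) × z₂ ≡ p₂ * + content (z₁ , z₂)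
  content-divides z₁ z₂ with ℤ∣.∣ᵤ⇒∣ {+ content (z₁ , z₂)} {z₁} (gcd[m,n]∣m ∣ z₁ ∣ ∣ z₂ ∣)
                           | ℤ∣.∣ᵤ⇒∣ {+ content (z₁ , z₂)} {z₂} (gcd[m,n]∣n ∣ z₁ ∣ ∣ z₂ ∣)
  ... | ℤ∣.divides p₁ z₁≡ | ℤ∣.divides p₂ z₂≡ = p₁ , p₂ , z₁≡ , z₂≡

  -- Opaque, like longestEdgeFirst below: only its type is used, and unfolding it when comparing
  -- counts of the resulting triangles makes type checking blow up.
  opaque
    standardForm : (T : LatticeTriangle) → StandardForm T
    standardForm (triangle (a₁ , a₂) (b₁ , b₂) (c₁ , c₂) nd)
      with s , t , bezout-u ← bezout (b₁ - a₁) (b₂ - a₂)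
         | p₁ , p₂ , u₁≡ , u₂≡ ← content-divides (b₁ - a₁) (b₂ - a₂)
      = Construction.standardForm a₁ a₂ b₁ b₂ c₁ c₂ nd p₁ p₂ s t u₁≡ u₂≡ bezout-u

module Sums where

  open import Data.Nat
  open import Data.Nat.Properties
  open import Data.Nat.DivMod using (_/_; _%_; m≡m%n+[m/n]*n; m%n<n)
  open import Data.Nat.Divisibility
  open import Data.Nat.GCD using (gcd; gcd[m,n]∣m; gcd[m,n]∣n; gcd[m,n]≡0⇒m≡0; c*gcd[m,n]≡gcd[cm,cn])
  open import Data.Nat.Coprimality using (Coprime; gcd≡1⇒coprime; coprime-divisor)
  open import Data.Nat.Tactic.RingSolver
  open import Data.Product using (_×_; _,_; proj₁; proj₂)
  open import Data.Sum using (_⊎_; [_,_]′)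
  open import Data.Empty using (⊥-elim)
  open import Data.List using (_++_; map; applyUpTo; filter; length; cartesianProduct)
  open import Data.List.Properties using (filter-++; length-++; map-applyUpTo)
  open import Relation.Nullary using (¬_; Dec; yes; no)
  open import Relation.Nullary.Decidable using (_×-dec_)
  open import Relation.Unary using (Pred; Decidable)
  open import Relation.Binary.PropositionalEquality
  open import Function.Bundles using (_⇔_; mk⇔; Equivalence)

  𝟙 : ∀ {A : Set} → Dec A → ℕ
  𝟙 (yes _) = 1
  𝟙 (no _) = 0

  𝟙-yes : ∀ {A : Set} (a : Dec A) → A → 𝟙 a ≡ 1
  𝟙-yes (yes _) _ = refl
  𝟙-yes (no ¬x) x = ⊥-elim (¬x x)

  𝟙-no : ∀ {A : Set} (a : Dec A) → ¬ A → 𝟙 a ≡ 0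
  𝟙-no (yes x) ¬x = ⊥-elim (¬x x)
  𝟙-no (no _) _ = refl

  𝟙-cong : ∀ {A B : Set} (a : Dec A) (b : Dec B) → A ⇔ B → 𝟙 a ≡ 𝟙 b
  𝟙-cong (yes _) (yes _) _ = refl
  𝟙-cong (no _) (no _) _ = refl
  𝟙-cong (yes x) (no ¬y) A⇔B = ⊥-elim (¬y (Equivalence.to A⇔B x))
  𝟙-cong (no ¬x) (yes y) A⇔B = ⊥-elim (¬x (Equivalence.from A⇔B y))

  𝟙-partition₂ : ∀ {A B C : Set} (a : Dec A) (b : Dec B) (c : Dec C) →
    (A → ¬ B) → (C → A ⊎ B) → (A → C) → (B → C) → 𝟙 a + 𝟙 b ≡ 𝟙 c
  𝟙-partition₂ (yes x) (yes y) _ disjoint _ _ _ = ⊥-elim (disjoint x y)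
  𝟙-partition₂ (yes x) (no _) c _ _ A⇒C _ = sym (𝟙-yes c (A⇒C x))
  𝟙-partition₂ (no _) (yes y) c _ _ _ B⇒C = sym (𝟙-yes c (B⇒C y))
  𝟙-partition₂ (no ¬x) (no ¬y) c _ C⇒A⊎B _ _ = sym (𝟙-no c λ z → [ ¬x , ¬y ]′ (C⇒A⊎B z))

  𝟙-partition₃ : ∀ {A B C E : Set} (a : Dec A) (b : Dec B) (c : Dec C) (d : Dec E) →
    (A → ¬ B) → (A → ¬ C) → (B → ¬ C) → (E → A ⊎ B ⊎ C) → (A → E) → (B → E) → (C → E) →
    𝟙 a + 𝟙 b + 𝟙 c ≡ 𝟙 d
  𝟙-partition₃ (yes x) (yes y) _ _ A#B _ _ _ _ _ _ = ⊥-elim (A#B x y)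
  𝟙-partition₃ (yes x) (no _) (yes z) _ _ A#C _ _ _ _ _ = ⊥-elim (A#C x z)
  𝟙-partition₃ (no _) (yes y) (yes z) _ _ _ B#C _ _ _ _ = ⊥-elim (B#C y z)
  𝟙-partition₃ (yes x) (no _) (no _) d _ _ _ _ A⇒E _ _ = sym (𝟙-yes d (A⇒E x))
  𝟙-partition₃ (no _) (yes y) (no _) d _ _ _ _ _ B⇒E _ = sym (𝟙-yes d (B⇒E y))
  𝟙-partition₃ (no _) (no _) (yes z) d _ _ _ _ _ _ C⇒E = sym (𝟙-yes d (C⇒E z))
  𝟙-partition₃ (no ¬x) (no ¬y) (no ¬z) d _ _ _ E⇒A⊎B⊎C _ _ _ = sym (𝟙-no d λ w → [ ¬x , [ ¬y , ¬z ]′ ]′ (E⇒A⊎B⊎C w))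

  ∑ : (ℕ → ℕ) → ℕ → ℕ
  ∑ f zero = 0
  ∑ f (suc n) = f 0 + ∑ (λ k → f (suc k)) n

  ∑-last : ∀ f n → ∑ f (suc n) ≡ ∑ f n + f n
  ∑-last f zero = +-comm (f 0) 0
  ∑-last f (suc n) = trans (cong (f 0 +_) (∑-last (λ k → f (suc k)) n)) (sym (+-assoc (f 0) _ _))

  ∑-cong : ∀ {f g} n → (∀ k → k < n → f k ≡ g k) → ∑ f n ≡ ∑ g n
  ∑-cong zero _ = refl
  ∑-cong (suc n) f≡g = cong₂ _+_ (f≡g 0 z<s) (∑-cong n (λ k k<n → f≡g (suc k) (s<s k<n)))

  ∑-+ : ∀ f g n → ∑ (λ k → f k + g k) n ≡ ∑ f n + ∑ g n
  ∑-+ f g zero = refl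
  ∑-+ f g (suc n) = trans (cong (f 0 + g 0 +_) (∑-+ (λ k → f (suc k)) (λ k → g (suc k)) n)) (interchange (f 0) (g 0) _ _)
    where
    interchange : ∀ a b c d → a + b + (c + d) ≡ a + c + (b + d)
    interchange = solve-∀

  ∑-const : ∀ c n → ∑ (λ _ → c) n ≡ n * c
  ∑-const c zero = refl
  ∑-const c (suc n) = cong (c +_) (∑-const c n)

  ∑-split : ∀ f m n → ∑ f (m + n) ≡ ∑ f m + ∑ (λ k → f (m + k)) n
  ∑-split f zero n = refl
  ∑-split f (suc m) n = trans (cong (f 0 +_) (∑-split (λ k → f (suc k)) m n)) (sym (+-assoc (f 0) _ _))

  ∑-reverse : ∀ f n → ∑ f n ≡ ∑ (λ k → f (n ∸ suc k)) n
  ∑-reverse f zero = refl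
  ∑-reverse f (suc n) = begin
    ∑ f (suc n)                        ≡⟨ ∑-last f n ⟩
    ∑ f n + f n                        ≡⟨ +-comm (∑ f n) (f n) ⟩
    f n + ∑ f n                        ≡⟨ cong (f n +_) (∑-reverse f n) ⟩
    f n + ∑ (λ k → f (n ∸ suc k)) n    ∎
    where open ≡-Reasoning

  length-filter-applyUpTo : ∀ {A : Set} {P : Pred A _} (P? : Decidable P) (f : ℕ → A) n →
    length (filter P? (applyUpTo f n)) ≡ ∑ (λ k → 𝟙 (P? (f k))) n
  length-filter-applyUpTo P? f zero = refl
  length-filter-applyUpTo P? f (suc n) with P? (f 0)
  ... | yes _ = cong suc (length-filter-applyUpTo P? (λ k → f (suc k)) n)
  ... | no _ = length-filter-applyUpTo P? (λ k → f (suc k)) n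

  length-filter-cartesianProduct : ∀ {A B : Set} {P : Pred (A × B) _} (P? : Decidable P) (f : ℕ → A) (g : ℕ → B) n m →
    length (filter P? (cartesianProduct (applyUpTo f n) (applyUpTo g m))) ≡ ∑ (λ k → ∑ (λ j → 𝟙 (P? (f k , g j))) m) n
  length-filter-cartesianProduct P? f g zero m = refl
  length-filter-cartesianProduct P? f g (suc n) m = begin
    length (filter P? (row ++ rest))                 ≡⟨ cong length (filter-++ P? row rest) ⟩
    length (filter P? row ++ filter P? rest)         ≡⟨ length-++ (filter P? row) ⟩
    length (filter P? row) + length (filter P? rest) ≡⟨ cong₂ _+_ first-row (length-filter-cartesianProduct P? (λ k → f (suc k)) g n m) ⟩
    ∑ (λ j → 𝟙 (P? (f 0 , g j))) m + ∑ (λ k → ∑ (λ j → 𝟙 (P? (f (suc k) , g j))) m) n ∎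
    where
    open ≡-Reasoning
    row = map (f 0 ,_) (applyUpTo g m)
    rest = cartesianProduct (applyUpTo (λ k → f (suc k)) n) (applyUpTo g m)
    first-row = trans (cong (λ l → length (filter P? l)) (map-applyUpTo g (f 0 ,_) m)) (length-filter-applyUpTo P? (λ j → f 0 , g j) m)

  ∑𝟙-none : ∀ {A : ℕ → Set} (A? : ∀ k → Dec (A k)) n → (∀ k → k < n → ¬ A k) → ∑ (λ k → 𝟙 (A? k)) n ≡ 0
  ∑𝟙-none A? zero _ = refl
  ∑𝟙-none A? (suc n) none =
    cong₂ _+_ (𝟙-no (A? 0) (none 0 z<s)) (∑𝟙-none (λ k → A? (suc k)) n (λ k k<n → none (suc k) (s<s k<n)))

  ∑𝟙-all : ∀ {A : ℕ → Set} (A? : ∀ k → Dec (A k)) n → (∀ k → k < n → A k) → ∑ (λ k → 𝟙 (A? k)) n ≡ n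
  ∑𝟙-all A? zero _ = refl
  ∑𝟙-all A? (suc n) all =
    cong₂ _+_ (𝟙-yes (A? 0) (all 0 z<s)) (∑𝟙-all (λ k → A? (suc k)) n (λ k k<n → all (suc k) (s<s k<n)))

  ∑𝟙-unique : ∀ {A : ℕ → Set} (A? : ∀ k → Dec (A k)) n k₀ → k₀ < n → A k₀ → (∀ k → k < n → A k → k ≡ k₀) →
    ∑ (λ k → 𝟙 (A? k)) n ≡ 1
  ∑𝟙-unique A? (suc n) zero _ Ak₀ unique =
    cong₂ _+_ (𝟙-yes (A? 0) Ak₀) (∑𝟙-none (λ k → A? (suc k)) n (λ k k<n Ak → 0≢1+n (sym (unique (suc k) (s<s k<n) Ak))))
  ∑𝟙-unique A? (suc n) (suc k₀) (s<s k₀<n) Ak₀ unique =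
    cong₂ _+_ (𝟙-no (A? 0) (λ A0 → 0≢1+n (unique 0 z<s A0)))
              (∑𝟙-unique (λ k → A? (suc k)) n k₀ k₀<n Ak₀ (λ k k<n Ak → suc-injective (unique (suc k) (s<s k<n) Ak)))

  ∑𝟙-interval : ∀ {A : ℕ → Set} (A? : ∀ k → Dec (A k)) lo L n → lo + L ≤ n →
    (∀ j → A j ⇔ (lo ≤ j × j < lo + L)) → ∑ (λ k → 𝟙 (A? k)) n ≡ L
  ∑𝟙-interval A? lo L n lo+L≤n A⇔ = begin
    ∑ f n                                                      ≡⟨ cong (∑ f) (m+[n∸m]≡n lo+L≤n) ⟨
    ∑ f (lo + L + (n ∸ (lo + L)))                              ≡⟨ ∑-split f (lo + L) _ ⟩
    ∑ f (lo + L) + ∑ (λ k → f (lo + L + k)) (n ∸ (lo + L))     ≡⟨ cong₂ _+_ (∑-split f lo L) above ⟩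
    ∑ f lo + ∑ (λ k → f (lo + k)) L + 0                        ≡⟨ cong (λ x → x + ∑ (λ k → f (lo + k)) L + 0) below ⟩
    ∑ (λ k → f (lo + k)) L + 0                                 ≡⟨ +-identityʳ _ ⟩
    ∑ (λ k → f (lo + k)) L                                     ≡⟨ inside ⟩
    L                                                          ∎
    where
    open ≡-Reasoning
    f = λ k → 𝟙 (A? k)
    below = ∑𝟙-none A? lo (λ k k<lo Ak → <⇒≱ k<lo (proj₁ (Equivalence.to (A⇔ k) Ak)))
    above = ∑𝟙-none (λ k → A? (lo + L + k)) (n ∸ (lo + L))
              (λ k _ Ak → <⇒≱ (proj₂ (Equivalence.to (A⇔ _) Ak)) (m≤m+n (lo + L) k))
    inside = ∑𝟙-all (λ k → A? (lo + k)) L (λ k k<L → Equivalence.from (A⇔ _) (m≤m+n lo k , +-monoʳ-< lo k<L))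

  ∑𝟙-multiple≡ : ∀ M h .{{_ : NonZero h}} α → α < M * h → ∑ (λ j → 𝟙 (j * h ≟ α)) M ≡ 𝟙 (h ∣? α)
  ∑𝟙-multiple≡ M h α α<Mh with h ∣? α
  ... | yes (divides t refl) =
    ∑𝟙-unique (λ j → j * h ≟ t * h) M t (*-cancelʳ-< h t M α<Mh) refl (λ k _ kh≡th → *-cancelʳ-≡ k t h kh≡th)
  ... | no h∤α = ∑𝟙-none (λ j → j * h ≟ α) M (λ k _ kh≡α → h∤α (divides k (sym kh≡α)))

  ∑𝟙-multiples-between : ∀ M h .{{_ : NonZero h}} γ e → 1 ≤ e → γ + e * h ≤ M * h →
    ∑ (λ j → 𝟙 ((γ <? j * h) ×-dec (j * h <? γ + e * h))) M + 𝟙 (h ∣? γ) ≡ e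
  ∑𝟙-multiples-between M h γ (suc e′) _ bound with h ∣? γ
  ... | yes (divides m refl) = begin
    ∑ f M + 1  ≡⟨ cong (_+ 1) (∑𝟙-interval between? (suc m) e′ M lo+L≤M between⇔) ⟩
    e′ + 1     ≡⟨ +-comm e′ 1 ⟩
    suc e′     ∎
    where
    open ≡-Reasoning
    e = suc e′
    between? = λ j → (m * h <? j * h) ×-dec (j * h <? m * h + e * h)
    f = λ j → 𝟙 (between? j)
    top : m * h + e * h ≡ (suc m + e′) * h
    top = trans (sym (*-distribʳ-+ h m e)) (cong (_* h) (+-suc m e′))
    lo+L≤M : suc m + e′ ≤ M
    lo+L≤M = *-cancelʳ-≤ (suc m + e′) M h (subst (_≤ M * h) top bound)
    between⇔ : ∀ j → ((m * h < j * h) × (j * h < m * h + e * h)) ⇔ (suc m ≤ j × j < suc m + e′)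
    between⇔ j = mk⇔ (λ (p , q) → *-cancelʳ-< h m j p , *-cancelʳ-< h j (suc m + e′) (subst (j * h <_) top q))
                     (λ (p , q) → *-monoˡ-< h p , subst (j * h <_) (sym top) (*-monoˡ-< h q))
  ... | no h∤γ = trans (+-identityʳ _) (∑𝟙-interval between? (suc m) e M lo+L≤M between⇔)
    where
    e = suc e′
    m = γ / h
    ρ = γ % h
    γ≡ : γ ≡ ρ + m * h
    γ≡ = m≡m%n+[m/n]*n γ h
    ρ<h : ρ < h
    ρ<h = m%n<n γ h
    0<ρ : 0 < ρ
    0<ρ = n≢0⇒n>0 (λ ρ≡0 → h∤γ (divides m (trans γ≡ (cong (_+ m * h) ρ≡0))))
    γ+eh≡ : γ + e * h ≡ ρ + (m + e) * h
    γ+eh≡ = trans (cong (_+ e * h) γ≡) (regroup ρ m e h)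
      where
      regroup : ∀ ρ m e h → ρ + m * h + e * h ≡ ρ + (m + e) * h
      regroup = solve-∀
    between? = λ j → (γ <? j * h) ×-dec (j * h <? γ + e * h)
    lo+L≤M : suc m + e ≤ M
    lo+L≤M = *-cancelʳ-< h (m + e) M (<-≤-trans (subst ((m + e) * h <_) (sym γ+eh≡) (m<n+m ((m + e) * h) 0<ρ)) bound)
    -- Since 0 < ρ < h, the point ρ + n h lies strictly between the multiples n h and (n + 1) h.
    above-ρ+mh : ∀ n j → (ρ + n * h < j * h) ⇔ (n < j)
    above-ρ+mh n j = mk⇔
      (λ lt → ≰⇒> λ j≤n → <⇒≱ lt (≤-trans (*-monoˡ-≤ h j≤n) (m≤n+m (n * h) ρ)))
      (λ n<j → <-≤-trans (+-monoˡ-< (n * h) ρ<h) (*-monoˡ-≤ h n<j))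
    below-ρ+mh : ∀ n j → (j * h < ρ + n * h) ⇔ (j ≤ n)
    below-ρ+mh n j = mk⇔
      (λ lt → ≮⇒≥ λ n<j → <⇒≱ lt (<⇒≤ (Equivalence.from (above-ρ+mh n j) n<j)))
      (λ j≤n → <-≤-trans (+-monoˡ-< (j * h) 0<ρ) (+-monoʳ-≤ ρ (*-monoˡ-≤ h j≤n)))
    between⇔ : ∀ j → ((γ < j * h) × (j * h < γ + e * h)) ⇔ (suc m ≤ j × j < suc m + e)
    between⇔ j = mk⇔
      (λ (p , q) → Equivalence.to (above-ρ+mh m j) (subst (_< j * h) γ≡ p) ,
                   s≤s (Equivalence.to (below-ρ+mh (m + e) j) (subst (j * h <_) γ+eh≡ q)))
      (λ (p , q) → subst (_< j * h) (sym γ≡) (Equivalence.from (above-ρ+mh m j) p) ,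
                   subst (j * h <_) (sym γ+eh≡) (Equivalence.from (below-ρ+mh (m + e) j) (s≤s⁻¹ q)))

  ∑𝟙-∣ : ∀ d .{{_ : NonZero d}} g → ∑ (λ k → 𝟙 (d ∣? k)) (g * d) ≡ g
  ∑𝟙-∣ d zero = refl
  ∑𝟙-∣ d (suc g) = begin
    ∑ f (d + g * d)                          ≡⟨ ∑-split f d (g * d) ⟩
    ∑ f d + ∑ (λ k → f (d + k)) (g * d)      ≡⟨ cong₂ _+_ one-period (∑-cong (g * d) λ k _ → 𝟙-cong (d ∣? (d + k)) (d ∣? k) (shift k)) ⟩
    1 + ∑ f (g * d)                          ≡⟨ cong suc (∑𝟙-∣ d g) ⟩
    suc g                                    ∎
    where
    open ≡-Reasoning
    f = λ k → 𝟙 (d ∣? k)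
    shift : ∀ k → d ∣ d + k ⇔ d ∣ k
    shift k = mk⇔ (λ p → ∣m+n∣m⇒∣n p ∣-refl) (λ p → ∣m∣n⇒∣m+n ∣-refl p)
    one-period : ∑ f d ≡ 1
    one-period = ∑𝟙-unique (d ∣?_) d 0 (>-nonZero⁻¹ d) (d ∣0) λ where
      zero _ _ → refl
      (suc k) k<d d∣k → ⊥-elim (<⇒≱ k<d (∣⇒≤ d∣k))

  -- With g = gcd h a, h = d g and a = a′ g where d and a′ are coprime, so h ∣ k a iff d ∣ k.
  ∑𝟙-∣-multiple : ∀ h .{{_ : NonZero h}} a → ∑ (λ k → 𝟙 (h ∣? k * a)) h ≡ gcd h a
  ∑𝟙-∣-multiple h a with gcd[m,n]∣m h a | gcd[m,n]∣n h a
  ... | divides d h≡dg | divides a′ a≡a′g = begin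
    ∑ (λ k → 𝟙 (h ∣? k * a)) h    ≡⟨ ∑-cong h (λ k _ → 𝟙-cong (h ∣? k * a) (d ∣? k) (h∣ka⇔d∣k k)) ⟩
    ∑ (λ k → 𝟙 (d ∣? k)) h        ≡⟨ cong (∑ (λ k → 𝟙 (d ∣? k))) (trans h≡dg (*-comm d g)) ⟩
    ∑ (λ k → 𝟙 (d ∣? k)) (g * d)  ≡⟨ ∑𝟙-∣ d g ⟩
    g                             ∎
    where
    open ≡-Reasoning
    g = gcd h a
    instance
      g-nonZero : NonZero g
      g-nonZero = ≢-nonZero (λ g≡0 → ≢-nonZero⁻¹ h (gcd[m,n]≡0⇒m≡0 g≡0))
      d-nonZero : NonZero d
      d-nonZero = ≢-nonZero (λ d≡0 → ≢-nonZero⁻¹ h (trans h≡dg (cong (_* g) d≡0)))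
    coprime : Coprime d a′
    coprime = gcd≡1⇒coprime (*-cancelˡ-≡ (gcd d a′) 1 g (begin
      g * gcd d a′          ≡⟨ c*gcd[m,n]≡gcd[cm,cn] g d a′ ⟩
      gcd (g * d) (g * a′)  ≡⟨ cong₂ gcd (trans (*-comm g d) (sym h≡dg)) (trans (*-comm g a′) (sym a≡a′g)) ⟩
      g                     ≡⟨ *-identityʳ g ⟨
      g * 1                 ∎))
    h∣ka⇔d∣k : ∀ k → (h ∣ k * a) ⇔ (d ∣ k)
    h∣ka⇔d∣k k = mk⇔
      (λ h∣ka → coprime-divisor coprime (subst (d ∣_) (*-comm k a′)
                   (*-cancelʳ-∣ g (subst₂ _∣_ h≡dg (trans (cong (k *_) a≡a′g) (sym (*-assoc k a′ g))) h∣ka))))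
      (λ d∣k → subst₂ _∣_ (sym h≡dg) (trans (*-assoc k a′ g) (cong (k *_) (sym a≡a′g))) (*-pres-∣ (∣m⇒∣m*n a′ d∣k) (∣-refl {g})))

module StandardCount where

  open import Defs
  open NormalForm using (standard; standard-weight₁; standard-weight₂; standard-weight₃)
  open Sums
  open import Data.Nat
  open import Data.Nat.Properties
  open import Data.Nat.Divisibility using (_∣?_; _∣0; ∣m+n∣m⇒∣n; ∣m∣n⇒∣m+n; n∣m*n)
  open import Data.Nat.GCD using (gcd)
  open import Data.Nat.Tactic.RingSolver
  open import Data.Integer as Int using (0ℤ; +≤+; +<+) renaming (+_ to pos)
  import Data.Integer.Properties as ℤP
  import Data.Integer.Tactic.RingSolver as ℤRing
  open import Data.Product using (_×_; _,_; proj₁; proj₂)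
  open import Data.Sum using (_⊎_; inj₁; inj₂)
  open import Data.List using (applyUpTo; cartesianProduct; filter; length)
  open import Data.List.Properties using (map-upTo)
  open import Relation.Nullary using (Dec; yes; no)
  open import Relation.Nullary.Decidable using (_×-dec_)
  open import Relation.Binary.PropositionalEquality
  open import Relation.Binary.Definitions using (tri<; tri≈; tri>)
  open import Function.Bundles using (_⇔_; mk⇔; Equivalence)

  0≤c*[x-y]⇔y≤x : ∀ c .{{_ : NonZero c}} x y → (0ℤ Int.≤ pos c Int.* (pos x Int.- pos y)) ⇔ (y ≤ x)
  0≤c*[x-y]⇔y≤x (suc c) x y = mk⇔
    (λ 0≤ → ℤP.drop‿+≤+ (ℤP.0≤i-j⇒j≤i (ℤP.*-cancelˡ-≤-pos 0ℤ (pos x Int.- pos y) C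
              (subst (Int._≤ C Int.* (pos x Int.- pos y)) (sym (ℤP.*-zeroʳ C)) 0≤))))
    (λ y≤x → subst (Int._≤ C Int.* (pos x Int.- pos y)) (ℤP.*-zeroʳ C)
              (ℤP.*-monoˡ-≤-nonNeg C (ℤP.i≤j⇒0≤j-i (+≤+ y≤x))))
    where C = pos (suc c)

  i<j⇔0<j-i : ∀ i j → (i Int.< j) ⇔ (0ℤ Int.< j Int.- i)
  i<j⇔0<j-i i j = mk⇔
    (λ i<j → subst (Int._< j Int.- i) (ℤP.+-inverseʳ i) (ℤP.+-monoˡ-< (Int.- i) i<j))
    (λ 0<j-i → subst₂ Int._<_ (ℤP.+-identityˡ i) (cancel j i) (ℤP.+-monoˡ-< i 0<j-i))
    where
    cancel : ∀ j i → j Int.- i Int.+ i ≡ j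
    cancel = ℤRing.solve-∀

  0<c*[x-y]⇔y<x : ∀ c .{{_ : NonZero c}} x y → (0ℤ Int.< pos c Int.* (pos x Int.- pos y)) ⇔ (y < x)
  0<c*[x-y]⇔y<x (suc c) x y = mk⇔
    (λ 0< → ℤP.drop‿+<+ (Equivalence.from (i<j⇔0<j-i (pos y) (pos x))
              (ℤP.*-cancelˡ-<-nonNeg (pos (suc c)) (subst (Int._< C Int.* (pos x Int.- pos y)) (sym (ℤP.*-zeroʳ C)) 0<))))
    (λ y<x → subst (Int._< C Int.* (pos x Int.- pos y)) (ℤP.*-zeroʳ C)
              (ℤP.*-monoˡ-<-pos C (Equivalence.to (i<j⇔0<j-i (pos y) (pos x)) (+<+ y<x))))
    where C = pos (suc c)

  module StandardTriangle (e h r : ℕ) .{{_ : NonZero e}} .{{_ : NonZero h}} where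

    -- The lattice points of the triangle are the (k , j) with k ≤ h and j < rows.
    rows : ℕ
    rows = suc (e + r)

    Closed : ℕ → ℕ → Set
    Closed k j = (j * h ≤ e * h + k * r) × (k * (e + r) ≤ j * h) × (0 ≤ e * k)

    closed? : ∀ k j → Dec (Closed k j)
    closed? k j = (j * h ≤? e * h + k * r) ×-dec ((k * (e + r) ≤? j * h) ×-dec (0 ≤? e * k))

    Open : ℕ → ℕ → Set
    Open k j = (j * h < e * h + k * r) × (k * (e + r) < j * h) × (0 < e * k)

    open? : ∀ k j → Dec (Open k j)
    open? k j = (j * h <? e * h + k * r) ×-dec ((k * (e + r) <? j * h) ×-dec (0 <? e * k))

    instance
      eh-nonZero : NonZero (e * h)
      eh-nonZero = m*n≢0 e h

    InT⇔Closed : ∀ k j → InT (standard e h r) (pos k , pos j) ⇔ Closed k j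
    InT⇔Closed k j = mk⇔
      (λ (p , q , s) → to (standard-weight₁ e h r k j) p , to (standard-weight₂ e h r k j) q , to (standard-weight₃ e h r k j) s)
      (λ (p , q , s) → from (standard-weight₁ e h r k j) p , from (standard-weight₂ e h r k j) q , from (standard-weight₃ e h r k j) s)
      where
      to : ∀ {w x y} → w ≡ pos (e * h) Int.* (pos x Int.- pos y) → 0ℤ Int.≤ w → y ≤ x
      to refl = Equivalence.to (0≤c*[x-y]⇔y≤x (e * h) _ _)
      from : ∀ {w x y} → w ≡ pos (e * h) Int.* (pos x Int.- pos y) → y ≤ x → 0ℤ Int.≤ w
      from refl = Equivalence.from (0≤c*[x-y]⇔y≤x (e * h) _ _)

    InInterior⇔Open : ∀ k j → InInterior (standard e h r) (pos k , pos j) ⇔ Open k j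
    InInterior⇔Open k j = mk⇔
      (λ (p , q , s) → to (standard-weight₁ e h r k j) p , to (standard-weight₂ e h r k j) q , to (standard-weight₃ e h r k j) s)
      (λ (p , q , s) → from (standard-weight₁ e h r k j) p , from (standard-weight₂ e h r k j) q , from (standard-weight₃ e h r k j) s)
      where
      to : ∀ {w x y} → w ≡ pos (e * h) Int.* (pos x Int.- pos y) → 0ℤ Int.< w → y < x
      to refl = Equivalence.to (0<c*[x-y]⇔y<x (e * h) _ _)
      from : ∀ {w x y} → w ≡ pos (e * h) Int.* (pos x Int.- pos y) → y < x → 0ℤ Int.< w
      from refl = Equivalence.from (0<c*[x-y]⇔y<x (e * h) _ _)

    closedColumn : ℕ → ℕ
    closedColumn k = ∑ (λ j → 𝟙 (closed? k j)) rows

    openColumn : ℕ → ℕ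
    openColumn k = ∑ (λ j → 𝟙 (open? k j)) rows

    onEdge₁₃ : ℕ → ℕ
    onEdge₁₃ k = 𝟙 (h ∣? k * (e + r))

    onEdge₂₃ : ℕ → ℕ
    onEdge₂₃ k = 𝟙 (h ∣? k * r)

    eh+hr≡[e+r]h : e * h + h * r ≡ (e + r) * h
    eh+hr≡[e+r]h = identity e h r
      where
      identity : ∀ e h r → e * h + h * r ≡ (e + r) * h
      identity = solve-∀

    closedColumn-0 : closedColumn 0 ≡ suc e
    closedColumn-0 = ∑𝟙-interval (closed? 0) 0 (suc e) rows (s≤s (m≤m+n e r)) λ j → mk⇔
      (λ (p , _ , _) → z≤n , s≤s (*-cancelʳ-≤ j e h (subst (j * h ≤_) (+-identityʳ _) p)))
      (λ (_ , q) → subst (j * h ≤_) (sym (+-identityʳ (e * h))) (*-monoˡ-≤ h (s≤s⁻¹ q)) , z≤n , z≤n)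

    openColumn-0 : openColumn 0 ≡ 0
    openColumn-0 = ∑𝟙-none (open? 0) rows λ j _ (_ , _ , 0<e*0) → <-irrefl (sym (*-zeroʳ e)) 0<e*0

    closedColumn-h : closedColumn h ≡ 1
    closedColumn-h = ∑𝟙-interval (closed? h) (e + r) 1 rows (≤-reflexive (+-comm (e + r) 1)) λ j → mk⇔
      (λ (p , q , _) → *-cancelʳ-≤ (e + r) j h (subst (_≤ j * h) (*-comm h (e + r)) q) ,
                       subst (j <_) (+-comm 1 (e + r)) (s≤s (*-cancelʳ-≤ j (e + r) h (subst (j * h ≤_) eh+hr≡[e+r]h p))))
      (λ (p , q) → subst (j * h ≤_) (sym eh+hr≡[e+r]h) (*-monoˡ-≤ h (s≤s⁻¹ (subst (j <_) (+-comm (e + r) 1) q))) ,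
                   subst (_≤ j * h) (*-comm (e + r) h) (*-monoˡ-≤ h p) , z≤n)

    openColumn-h : openColumn h ≡ 0
    openColumn-h = ∑𝟙-none (open? h) rows λ j _ (p , q , _) →
      <-asym (subst (_< j * h) (*-comm h (e + r)) q) (subst (j * h <_) eh+hr≡[e+r]h p)

    module Inner (k : ℕ) .{{_ : NonZero k}} (k<h : k < h) where

      k[e+r]<eh+kr : k * (e + r) < e * h + k * r
      k[e+r]<eh+kr = subst (_< e * h + k * r) (sym (*-distribˡ-+ k e r))
        (+-monoˡ-< (k * r) (subst (k * e <_) (*-comm h e) (*-monoˡ-< e k<h)))

      0<ek : 0 < e * k
      0<ek = >-nonZero⁻¹ (e * k) {{m*n≢0 e k}}

      k[e+r]<rows*h : k * (e + r) < rows * h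
      k[e+r]<rows*h = ≤-<-trans (*-monoˡ-≤ (e + r) (<⇒≤ k<h))
                        (subst (_< h + (e + r) * h) (*-comm (e + r) h) (m<n+m _ (>-nonZero⁻¹ h)))

      eh+kr<rows*h : e * h + k * r < rows * h
      eh+kr<rows*h = ≤-<-trans (+-monoʳ-≤ (e * h) (*-monoˡ-≤ r (<⇒≤ k<h)))
                       (subst (_< h + (e + r) * h) (sym eh+hr≡[e+r]h) (m<n+m ((e + r) * h) (>-nonZero⁻¹ h)))

      -- The boundary points of column k are its two ends, when these are lattice points.
      closedColumn-inner : closedColumn k ≡ openColumn k + onEdge₁₃ k + onEdge₂₃ k
      closedColumn-inner = begin
        closedColumn k
          ≡⟨ ∑-cong rows (λ j _ → sym (pointwise j)) ⟩
        ∑ (λ j → 𝟙 (open? k j) + 𝟙 (lower? j) + 𝟙 (upper? j)) rows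
          ≡⟨ ∑-+ (λ j → 𝟙 (open? k j) + 𝟙 (lower? j)) (λ j → 𝟙 (upper? j)) rows ⟩
        ∑ (λ j → 𝟙 (open? k j) + 𝟙 (lower? j)) rows + ∑ (λ j → 𝟙 (upper? j)) rows
          ≡⟨ cong (_+ ∑ (λ j → 𝟙 (upper? j)) rows) (∑-+ (λ j → 𝟙 (open? k j)) (λ j → 𝟙 (lower? j)) rows) ⟩
        openColumn k + ∑ (λ j → 𝟙 (lower? j)) rows + ∑ (λ j → 𝟙 (upper? j)) rows
          ≡⟨ cong₂ (λ x y → openColumn k + x + y) (∑𝟙-multiple≡ rows h (k * (e + r)) k[e+r]<rows*h)
                                                   (∑𝟙-multiple≡ rows h (e * h + k * r) eh+kr<rows*h) ⟩
        openColumn k + onEdge₁₃ k + 𝟙 (h ∣? e * h + k * r)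
          ≡⟨ cong (openColumn k + onEdge₁₃ k +_) (𝟙-cong (h ∣? e * h + k * r) (h ∣? k * r)
                    (mk⇔ (λ p → ∣m+n∣m⇒∣n p (n∣m*n e)) (λ p → ∣m∣n⇒∣m+n (n∣m*n e) p))) ⟩
        openColumn k + onEdge₁₃ k + onEdge₂₃ k ∎
        where
        open ≡-Reasoning
        lower? = λ j → j * h ≟ k * (e + r)
        upper? = λ j → j * h ≟ e * h + k * r
        pointwise : ∀ j → 𝟙 (open? k j) + 𝟙 (lower? j) + 𝟙 (upper? j) ≡ 𝟙 (closed? k j)
        pointwise j = 𝟙-partition₃ (open? k j) (lower? j) (upper? j) (closed? k j)
          (λ (_ , q , _) l → <-irrefl (sym l) q)
          (λ (p , _ , _) u → <-irrefl u p)
          (λ l u → <-irrefl (trans (sym l) u) k[e+r]<eh+kr)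
          split
          (λ (p , q , _) → <⇒≤ p , <⇒≤ q , z≤n)
          (λ l → subst (_≤ e * h + k * r) (sym l) (<⇒≤ k[e+r]<eh+kr) , ≤-reflexive (sym l) , z≤n)
          (λ u → ≤-reflexive u , subst (k * (e + r) ≤_) (sym u) (<⇒≤ k[e+r]<eh+kr) , z≤n)
          where
          split : Closed k j → Open k j ⊎ (j * h ≡ k * (e + r)) ⊎ (j * h ≡ e * h + k * r)
          split (p , q , _) with j * h ≟ e * h + k * r | j * h ≟ k * (e + r)
          ... | yes u | _ = inj₂ (inj₂ u)
          ... | no _ | yes l = inj₂ (inj₁ l)
          ... | no ¬u | no ¬l = inj₁ (≤∧≢⇒< p ¬u , ≤∧≢⇒< q (λ x → ¬l (sym x)) , 0<ek)

      -- The reflection j ↦ e + r - j maps the interior of column h - k onto the j with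
      -- k r < j h < k (e + r); with the interior of column k and the point (k , j) on the edge
      -- through the origin, these are exactly the j with k r < j h < k r + e h.
      private
        k′ = h ∸ k
        instance
          k′-nonZero : NonZero k′
          k′-nonZero = ≢-nonZero (m>n⇒m∸n≢0 k<h)

        k′+k≡h : k′ + k ≡ h
        k′+k≡h = m∸n+n≡m (<⇒≤ k<h)

        between? : ∀ j → Dec ((k * r < j * h) × (j * h < k * (e + r)))
        between? j = (k * r <? j * h) ×-dec (j * h <? k * (e + r))

        window? : ∀ j → Dec ((k * r < j * h) × (j * h < k * r + e * h))
        window? j = (k * r <? j * h) ×-dec (j * h <? k * r + e * h)

        <-transpose : ∀ a b c d → a + d ≡ b + c → (a < b) ⇔ (c < d)
        <-transpose a b c d a+d≡b+c = mk⇔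
          (λ a<b → +-cancelˡ-< b c d (subst (_< b + d) a+d≡b+c (+-monoˡ-< d a<b)))
          (λ c<d → +-cancelʳ-< d a b (subst (_< b + d) (sym a+d≡b+c) (+-monoʳ-< b c<d)))

        reflect : ∀ j → j < rows → Open k′ (e + r ∸ j) ⇔ ((k * r < j * h) × (j * h < k * (e + r)))
        reflect j j<rows = mk⇔
          (λ (p , q , _) → Equivalence.to upper p , Equivalence.to lower q)
          (λ (p , q) → Equivalence.from upper p , Equivalence.from lower q ,
                       >-nonZero⁻¹ (e * k′) {{m*n≢0 e k′}})
          where
          t = e + r ∸ j
          t+j≡e+r : t + j ≡ e + r
          t+j≡e+r = m∸n+n≡m (s≤s⁻¹ j<rows)
          upper : (t * h < e * h + k′ * r) ⇔ (k * r < j * h)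
          upper = <-transpose (t * h) (e * h + k′ * r) (k * r) (j * h) (begin
            t * h + j * h            ≡⟨ *-distribʳ-+ h t j ⟨
            (t + j) * h              ≡⟨ cong (_* h) t+j≡e+r ⟩
            (e + r) * h              ≡⟨ cong (λ x → (e + r) * x) k′+k≡h ⟨
            (e + r) * (k′ + k)             ≡⟨ expand e r k′ k ⟩
            e * (k′ + k) + k′ * r + k * r  ≡⟨ cong (λ x → e * x + k′ * r + k * r) k′+k≡h ⟩
            e * h + k′ * r + k * r         ∎)
            where
            open ≡-Reasoning
            expand : ∀ e r k′ k → (e + r) * (k′ + k) ≡ e * (k′ + k) + k′ * r + k * r
            expand = solve-∀
          lower : (k′ * (e + r) < t * h) ⇔ (j * h < k * (e + r))
          lower = <-transpose (k′ * (e + r)) (t * h) (j * h) (k * (e + r)) (begin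
            k′ * (e + r) + k * (e + r)   ≡⟨ *-distribʳ-+ (e + r) k′ k ⟨
            (k′ + k) * (e + r)           ≡⟨ cong (_* (e + r)) k′+k≡h ⟩
            h * (e + r)                  ≡⟨ *-comm h (e + r) ⟩
            (e + r) * h                  ≡⟨ cong (_* h) t+j≡e+r ⟨
            (t + j) * h                  ≡⟨ *-distribʳ-+ h t j ⟩
            t * h + j * h                ∎)
            where open ≡-Reasoning

        openColumn-reflected : openColumn k′ ≡ ∑ (λ j → 𝟙 (between? j)) rows
        openColumn-reflected = trans (∑-reverse (λ j → 𝟙 (open? k′ j)) rows)
          (∑-cong rows (λ j j<rows → 𝟙-cong (open? k′ (e + r ∸ j)) (between? j) (reflect j j<rows)))

        k[e+r]<kr+eh : k * (e + r) < k * r + e * h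
        k[e+r]<kr+eh = subst (k * (e + r) <_) (+-comm (e * h) (k * r)) k[e+r]<eh+kr

        pointwise : ∀ j → 𝟙 (open? k j) + 𝟙 (between? j) + 𝟙 (j * h ≟ k * (e + r)) ≡ 𝟙 (window? j)
        pointwise j = 𝟙-partition₃ (open? k j) (between? j) (j * h ≟ k * (e + r)) (window? j)
          (λ (_ , q , _) (_ , c) → <-asym q c)
          (λ (_ , q , _) l → <-irrefl (sym l) q)
          (λ (_ , c) l → <-irrefl l c)
          split
          (λ (p , q , _) → ≤-<-trans (*-monoʳ-≤ k (m≤n+m r e)) q , subst (j * h <_) (+-comm (e * h) (k * r)) p)
          (λ (a , c) → a , <-trans c k[e+r]<kr+eh)
          (λ l → subst (k * r <_) (sym l) (subst (k * r <_) (sym (*-distribˡ-+ k e r)) (m<n+m (k * r) (>-nonZero⁻¹ (k * e) {{m*n≢0 k e}}))) ,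
                 subst (_< k * r + e * h) (sym l) k[e+r]<kr+eh)
          where
          split : (k * r < j * h) × (j * h < k * r + e * h) →
                  Open k j ⊎ ((k * r < j * h) × (j * h < k * (e + r))) ⊎ (j * h ≡ k * (e + r))
          split (a , c) with <-cmp (j * h) (k * (e + r))
          ... | tri< x _ _ = inj₂ (inj₁ (a , x))
          ... | tri≈ _ x _ = inj₂ (inj₂ x)
          ... | tri> _ _ x = inj₁ (subst (j * h <_) (+-comm (k * r) (e * h)) c , x , 0<ek)

        kr+eh≤rows*h : k * r + e * h ≤ rows * h
        kr+eh≤rows*h = ≤-trans (+-monoˡ-≤ (e * h) (*-monoˡ-≤ r (<⇒≤ k<h)))
                         (≤-trans (≤-reflexive (trans (+-comm (h * r) (e * h)) eh+hr≡[e+r]h)) (m≤n+m ((e + r) * h) h))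

      openColumns-opposite : openColumn k + openColumn (h ∸ k) + onEdge₁₃ k + onEdge₂₃ k ≡ e
      openColumns-opposite = begin
        openColumn k + openColumn k′ + onEdge₁₃ k + onEdge₂₃ k
          ≡⟨ cong₂ (λ x y → openColumn k + x + y + onEdge₂₃ k) openColumn-reflected (sym (∑𝟙-multiple≡ rows h (k * (e + r)) k[e+r]<rows*h)) ⟩
        openColumn k + ∑ (λ j → 𝟙 (between? j)) rows + ∑ (λ j → 𝟙 (j * h ≟ k * (e + r))) rows + onEdge₂₃ k
          ≡⟨ cong (λ x → x + ∑ (λ j → 𝟙 (j * h ≟ k * (e + r))) rows + onEdge₂₃ k) (sym (∑-+ (λ j → 𝟙 (open? k j)) (λ j → 𝟙 (between? j)) rows)) ⟩
        ∑ (λ j → 𝟙 (open? k j) + 𝟙 (between? j)) rows + ∑ (λ j → 𝟙 (j * h ≟ k * (e + r))) rows + onEdge₂₃ k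
          ≡⟨ cong (_+ onEdge₂₃ k) (sym (∑-+ (λ j → 𝟙 (open? k j) + 𝟙 (between? j)) (λ j → 𝟙 (j * h ≟ k * (e + r))) rows)) ⟩
        ∑ (λ j → 𝟙 (open? k j) + 𝟙 (between? j) + 𝟙 (j * h ≟ k * (e + r))) rows + onEdge₂₃ k
          ≡⟨ cong (_+ onEdge₂₃ k) (∑-cong rows (λ j _ → pointwise j)) ⟩
        ∑ (λ j → 𝟙 (window? j)) rows + onEdge₂₃ k
          ≡⟨ ∑𝟙-multiples-between rows h (k * r) e (>-nonZero⁻¹ e) kr+eh≤rows*h ⟩
        e ∎
        where open ≡-Reasoning

    boxPoints-standard : boxPoints (standard e h r) ≡ cartesianProduct (applyUpTo pos (suc h)) (applyUpTo pos rows)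
    boxPoints-standard = cong₂ cartesianProduct
      (trans (map-upTo _ (suc (h + 0))) (cong (λ n → applyUpTo pos (suc n)) (+-identityʳ h)))
      (trans (map-upTo _ (suc ((e ⊔ (e + r)) + 0)))
             (cong (λ n → applyUpTo pos (suc n)) (trans (+-identityʳ _) (m≤n⇒m⊔n≡n (m≤m+n e r)))))

    b≡∑ : b (standard e h r) ≡ ∑ (λ k → ∑ (λ j → 𝟙 (onBoundary? (standard e h r) (pos k , pos j))) rows) (suc h)
    b≡∑ = trans (cong (λ l → length (filter (onBoundary? (standard e h r)) l)) boxPoints-standard)
                (length-filter-cartesianProduct (onBoundary? (standard e h r)) pos pos (suc h) rows)

    i≡∑ : i (standard e h r) ≡ ∑ (λ k → ∑ (λ j → 𝟙 (inInterior? (standard e h r) (pos k , pos j))) rows) (suc h)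
    i≡∑ = trans (cong (λ l → length (filter (inInterior? (standard e h r)) l)) boxPoints-standard)
                (length-filter-cartesianProduct (inInterior? (standard e h r)) pos pos (suc h) rows)

    b+i≡∑closedColumn : b (standard e h r) + i (standard e h r) ≡ ∑ closedColumn (suc h)
    b+i≡∑closedColumn = begin
      b (standard e h r) + i (standard e h r)
        ≡⟨ cong₂ _+_ b≡∑ i≡∑ ⟩
      ∑ (λ k → ∑ (boundary k) rows) (suc h) + ∑ (λ k → ∑ (interior k) rows) (suc h)
        ≡⟨ ∑-+ (λ k → ∑ (boundary k) rows) (λ k → ∑ (interior k) rows) (suc h) ⟨
      ∑ (λ k → ∑ (boundary k) rows + ∑ (interior k) rows) (suc h)
        ≡⟨ ∑-cong (suc h) (λ k _ → trans (sym (∑-+ (boundary k) (interior k) rows)) (∑-cong rows (λ j _ → pointwise k j))) ⟩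
      ∑ closedColumn (suc h) ∎
      where
      open ≡-Reasoning
      boundary = λ k j → 𝟙 (onBoundary? (standard e h r) (pos k , pos j))
      interior = λ k j → 𝟙 (inInterior? (standard e h r) (pos k , pos j))
      pointwise : ∀ k j → boundary k j + interior k j ≡ 𝟙 (closed? k j)
      pointwise k j = trans
        (𝟙-partition₂ (onBoundary? (standard e h r) x) (inInterior? (standard e h r) x) (inT? (standard e h r) x) proj₂ split proj₁ (λ (p , q , s) → ℤP.<⇒≤ p , ℤP.<⇒≤ q , ℤP.<⇒≤ s))
        (𝟙-cong (inT? (standard e h r) x) (closed? k j) (InT⇔Closed k j))
        where
        x = pos k , pos j
        split : InT (standard e h r) x → OnBoundary (standard e h r) x ⊎ InInterior (standard e h r) x
        split x∈N with inInterior? (standard e h r) x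
        ... | yes interior = inj₂ interior
        ... | no ¬interior = inj₁ (x∈N , ¬interior)

    i≡∑openColumn : i (standard e h r) ≡ ∑ openColumn (suc h)
    i≡∑openColumn = trans i≡∑ (∑-cong (suc h) (λ k _ → ∑-cong rows (λ j _ →
      𝟙-cong (inInterior? (standard e h r) (pos k , pos j)) (open? k j) (InInterior⇔Open k j))))

    private
      h′ = pred h
      1+h′≡h : suc h′ ≡ h
      1+h′≡h = suc-pred h

    inner : (ℕ → ℕ) → ℕ
    inner f = ∑ (λ k → f (suc k)) h′

    ∑-first : ∀ f → ∑ f h ≡ f 0 + inner f
    ∑-first f = cong (∑ f) (sym 1+h′≡h)

    ∑-ends : ∀ f → ∑ f (suc h) ≡ f 0 + (inner f + f h)
    ∑-ends f = cong (f 0 +_) (begin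
      ∑ (λ k → f (suc k)) h        ≡⟨ cong (∑ (λ k → f (suc k))) 1+h′≡h ⟨
      ∑ (λ k → f (suc k)) (suc h′) ≡⟨ ∑-last (λ k → f (suc k)) h′ ⟩
      inner f + f (suc h′)         ≡⟨ cong (λ x → inner f + f x) 1+h′≡h ⟩
      inner f + f h                ∎)
      where open ≡-Reasoning

    1+k<h : ∀ {k} → k < h′ → suc k < h
    1+k<h k<h′ = subst (_ <_) 1+h′≡h (s≤s k<h′)

    onEdges : ℕ → ℕ
    onEdges k = onEdge₁₃ k + onEdge₂₃ k

    inner-closedColumn : inner closedColumn ≡ inner openColumn + inner onEdges
    inner-closedColumn = trans
      (∑-cong h′ (λ k k<h′ → trans (Inner.closedColumn-inner (suc k) (1+k<h k<h′)) (+-assoc (openColumn (suc k)) _ _)))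
      (∑-+ (λ k → openColumn (suc k)) (λ k → onEdges (suc k)) h′)

    1+inner-onEdge₁₃ : 1 + inner onEdge₁₃ ≡ gcd h (e + r)
    1+inner-onEdge₁₃ = trans (cong (_+ inner onEdge₁₃) (sym (𝟙-yes (h ∣? 0) (h ∣0)))) (trans (sym (∑-first onEdge₁₃)) (∑𝟙-∣-multiple h (e + r)))

    1+inner-onEdge₂₃ : 1 + inner onEdge₂₃ ≡ gcd h r
    1+inner-onEdge₂₃ = trans (cong (_+ inner onEdge₂₃) (sym (𝟙-yes (h ∣? 0) (h ∣0)))) (trans (sym (∑-first onEdge₂₃)) (∑𝟙-∣-multiple h r))

    2+inner-onEdges : 2 + inner onEdges ≡ gcd h (e + r) + gcd h r
    2+inner-onEdges = begin
      2 + inner onEdges                                ≡⟨ cong (2 +_) (∑-+ (λ k → onEdge₁₃ (suc k)) (λ k → onEdge₂₃ (suc k)) h′) ⟩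
      2 + (inner onEdge₁₃ + inner onEdge₂₃)            ≡⟨ regroup (inner onEdge₁₃) (inner onEdge₂₃) ⟩
      (1 + inner onEdge₁₃) + (1 + inner onEdge₂₃)      ≡⟨ cong₂ _+_ 1+inner-onEdge₁₃ 1+inner-onEdge₂₃ ⟩
      gcd h (e + r) + gcd h r                          ∎
      where
      open ≡-Reasoning
      regroup : ∀ x y → 2 + (x + y) ≡ (1 + x) + (1 + y)
      regroup = solve-∀

    i≡inner-openColumn : i (standard e h r) ≡ inner openColumn
    i≡inner-openColumn = begin
      i (standard e h r)                                                  ≡⟨ i≡∑openColumn ⟩
      ∑ openColumn (suc h)                                 ≡⟨ ∑-ends openColumn ⟩
      openColumn 0 + (inner openColumn + openColumn h)     ≡⟨ cong₂ (λ x y → x + (inner openColumn + y)) openColumn-0 openColumn-h ⟩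
      inner openColumn + 0                                 ≡⟨ +-identityʳ _ ⟩
      inner openColumn                                     ∎
      where open ≡-Reasoning

    b-standard : b (standard e h r) ≡ e + gcd h (e + r) + gcd h r
    b-standard = +-cancelʳ-≡ (i (standard e h r)) (b (standard e h r)) (e + gcd h (e + r) + gcd h r) (begin
      b (standard e h r) + i (standard e h r)                                                  ≡⟨ b+i≡∑closedColumn ⟩
      ∑ closedColumn (suc h)                                     ≡⟨ ∑-ends closedColumn ⟩
      closedColumn 0 + (inner closedColumn + closedColumn h)     ≡⟨ cong₂ (λ x y → x + (inner closedColumn + y)) closedColumn-0 closedColumn-h ⟩
      suc e + (inner closedColumn + 1)                           ≡⟨ cong (λ x → suc e + (x + 1)) inner-closedColumn ⟩
      suc e + (inner openColumn + inner onEdges + 1)             ≡⟨ regroup e (inner openColumn) (inner onEdges) ⟩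
      e + (2 + inner onEdges) + inner openColumn                 ≡⟨ cong₂ (λ x y → e + x + y) 2+inner-onEdges (sym i≡inner-openColumn) ⟩
      e + (gcd h (e + r) + gcd h r) + i (standard e h r)                        ≡⟨ cong (_+ i (standard e h r)) (sym (+-assoc e _ _)) ⟩
      e + gcd h (e + r) + gcd h r + i (standard e h r)                          ∎)
      where
      open ≡-Reasoning
      regroup : ∀ e a x → suc e + (a + x + 1) ≡ e + (2 + x) + a
      regroup = solve-∀

    inner-openColumn-reversed : inner openColumn ≡ ∑ (λ k → openColumn (h ∸ suc k)) h′
    inner-openColumn-reversed = trans (∑-reverse (λ k → openColumn (suc k)) h′)
      (∑-cong h′ (λ k k<h′ → cong openColumn (trans (sym (+-∸-assoc 1 k<h′)) (cong (_∸ suc k) 1+h′≡h))))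

    2*inner-openColumn+inner-onEdges : inner openColumn + inner openColumn + inner onEdges ≡ h′ * e
    2*inner-openColumn+inner-onEdges = begin
      inner openColumn + inner openColumn + inner onEdges
        ≡⟨ cong (λ x → inner openColumn + x + inner onEdges) inner-openColumn-reversed ⟩
      inner openColumn + ∑ (λ k → openColumn (h ∸ suc k)) h′ + inner onEdges
        ≡⟨ cong (_+ inner onEdges) (∑-+ (λ k → openColumn (suc k)) (λ k → openColumn (h ∸ suc k)) h′) ⟨
      ∑ (λ k → openColumn (suc k) + openColumn (h ∸ suc k)) h′ + inner onEdges
        ≡⟨ ∑-+ (λ k → openColumn (suc k) + openColumn (h ∸ suc k)) (λ k → onEdges (suc k)) h′ ⟨
      ∑ (λ k → openColumn (suc k) + openColumn (h ∸ suc k) + onEdges (suc k)) h′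
        ≡⟨ ∑-cong h′ (λ k k<h′ → trans (sym (+-assoc (openColumn (suc k) + openColumn (h ∸ suc k)) _ _))
                                       (Inner.openColumns-opposite (suc k) (1+k<h k<h′))) ⟩
      ∑ (λ _ → e) h′
        ≡⟨ ∑-const e h′ ⟩
      h′ * e ∎
      where open ≡-Reasoning

    pick-standard : 2 * i (standard e h r) + b (standard e h r) ≡ e * h + 2
    pick-standard = begin
      2 * i (standard e h r) + b (standard e h r)                                                   ≡⟨ cong₂ (λ x y → 2 * x + y) i≡inner-openColumn b-standard ⟩
      2 * inner openColumn + (e + gcd h (e + r) + gcd h r)           ≡⟨ cong (λ x → 2 * inner openColumn + x) (trans (+-assoc e _ _) (cong (e +_) (sym 2+inner-onEdges))) ⟩
      2 * inner openColumn + (e + (2 + inner onEdges))               ≡⟨ regroup (inner openColumn) (inner onEdges) e ⟩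
      (inner openColumn + inner openColumn + inner onEdges) + e + 2  ≡⟨ cong (λ x → x + e + 2) 2*inner-openColumn+inner-onEdges ⟩
      h′ * e + e + 2                                                  ≡⟨ cong (_+ 2) (+-comm (h′ * e) e) ⟩
      suc h′ * e + 2                                                  ≡⟨ cong (λ x → x * e + 2) 1+h′≡h ⟩
      h * e + 2                                                       ≡⟨ cong (_+ 2) (*-comm h e) ⟩
      e * h + 2                                                       ∎
      where
      open ≡-Reasoning
      regroup : ∀ a x e → 2 * a + (e + (2 + x)) ≡ (a + a + x) + e + 2
      regroup = solve-∀

module Arithmetic where

  open import Data.Nat
  open import Data.Nat.Properties
  open import Data.Nat.Divisibility using (_∣_; divides)
  open import Data.Nat.Tactic.RingSolver
  open import Data.Product using (_,_; proj₁; proj₂)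
  open import Data.Empty using (⊥; ⊥-elim)
  open import Relation.Nullary using (¬_; Dec; yes; no)
  open import Relation.Binary.PropositionalEquality

  2*proper-divisor≤ : ∀ {g h} .{{_ : NonZero h}} → g ∣ h → g ≢ h → 2 * g ≤ h
  2*proper-divisor≤ {g} {h} (divides zero refl) _ = ⊥-elim (≢-nonZero⁻¹ h refl)
  2*proper-divisor≤ {g} (divides (suc zero) refl) g≢h = ⊥-elim (g≢h (sym (+-identityʳ g)))
  2*proper-divisor≤ {g} (divides (suc (suc q)) refl) _ =
    subst (_≤ suc (suc q) * g) (sym (cong (g +_) (+-identityʳ g))) (+-monoʳ-≤ g (m≤m+n g (q * g)))

  ≮-by-excess : ∀ {X Y} Q → X ≡ Y + Q → ¬ X < Y
  ≮-by-excess {X} {Y} Q X≡Y+Q X<Y = <⇒≱ X<Y (subst (Y ≤_) (sym X≡Y+Q) (m≤m+n Y Q))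

  ay≤a²+y² : ∀ a y → a * y ≤ a * a + y * y
  ay≤a²+y² a y with a ≤? y
  ... | yes a≤y = ≤-trans (*-monoˡ-≤ y a≤y) (m≤n+m (y * y) (a * a))
  ... | no a≰y = ≤-trans (*-monoʳ-≤ a (<⇒≤ (≰⇒> a≰y))) (m≤m+n (a * a) (y * y))

  -- The three cases below are indexed by which of g₂, g₃ equal h; with a = c + 1 ≤ h = a + y
  -- and e = a + 1 + x, the second inequality of the theorem fails in the first two cases
  -- and the first one in the last.
  no-proper-proper : ∀ a x y → ¬ (suc a + x) * (a + y) + 2 * (a * a) < a * (suc a + x) + a * (a + y)
  no-proper-proper a x y = ≮-by-excess (a * a + y + x * y) (identity a x y)
    where
    identity : ∀ a x y → (suc a + x) * (a + y) + 2 * (a * a) ≡ a * (suc a + x) + a * (a + y) + (a * a + y + x * y)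
    identity = solve-∀

  no-full-proper : ∀ a y z → ¬ 2 * ((a + y + z) * (a + y) + 2 * (a * a)) < 2 * (a * (a + y + z)) + 2 * (a * (a + y)) + a * (a + y)
  no-full-proper a y z lt = <⇒≱ (+-cancelˡ-< R _ _ (subst (_< R + a * y) (identity a y z) (+-monoˡ-< (a * y) lt)))
    (subst (a * y ≤_) (+-assoc (a * a) (y * y) (y * y + 2 * y * z)) (≤-trans (ay≤a²+y² a y) (m≤m+n (a * a + y * y) (y * y + 2 * y * z))))
    where
    R = 2 * (a * (a + y + z)) + 2 * (a * (a + y)) + a * (a + y)
    identity : ∀ a y z → 2 * ((a + y + z) * (a + y) + 2 * (a * a)) + a * y
                         ≡ 2 * (a * (a + y + z)) + 2 * (a * (a + y)) + a * (a + y) + (a * a + (y * y + (y * y + 2 * y * z)))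
    identity = solve-∀

  full-full⇒1+x<a : ∀ a x y → (suc a + x) * (a + y) + 2 * (a * a) < a * (suc a + x) + a * (a + y) + a * (a + y) → suc x < a
  full-full⇒1+x<a a x y lt = *-cancelʳ-< y (suc x) a (+-cancelˡ-< K _ _ (subst₂ _<_ (identity₁ a x y) (identity₂ a x y) lt))
    where
    K = 3 * (a * a) + a + a * x + a * y
    identity₁ : ∀ a x y → (suc a + x) * (a + y) + 2 * (a * a) ≡ 3 * (a * a) + a + a * x + a * y + suc x * y
    identity₁ = solve-∀
    identity₂ : ∀ a x y → a * (suc a + x) + a * (a + y) + a * (a + y) ≡ 3 * (a * a) + a + a * x + a * y + a * y
    identity₂ = solve-∀

  no-full-full : ∀ x w → 1 ≤ x + w →
    let c = suc (x + w) ; h = suc c + suc x in ¬ c * (h + h + h) < h * h + 2 * c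
  no-full-full zero zero ()
  no-full-full zero (suc w) _ = ≮-by-excess (2 * w * w + 8 * w + 4) (identity w)
    where
    identity : ∀ w → let c = suc (suc w) ; h = suc c + 1 in c * (h + h + h) ≡ h * h + 2 * c + (2 * w * w + 8 * w + 4)
    identity = solve-∀
  no-full-full (suc x) w _ = ≮-by-excess (2 * x * x + 5 * x + 5 * x * w + 2 * w * w + 9 * w + 1) (identity x w)
    where
    identity : ∀ x w → let c = suc (suc x + w) ; h = suc c + suc (suc x) in
      c * (h + h + h) ≡ h * h + 2 * c + (2 * x * x + 5 * x + 5 * x * w + 2 * w * w + 9 * w + 1)
    identity = solve-∀

  -- Here g₂ and g₃ play the lattice lengths of the two shorter edges of a triangle, e that of the
  -- longest one and e h its normalised area, so that b = e + g₂ + g₃ and 2 i = e h + 2 - b.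
  lattice-lengths-incompatible : ∀ c e h g₂ g₃ .{{_ : NonZero h}} → 2 ≤ c → 1 ≤ g₂ → 1 ≤ g₃ → g₂ ∣ h → g₃ ∣ h →
    g₂ ≤ e → g₃ ≤ e → (g₂ ≡ h → g₃ ≡ h → h ∣ e) →
    c * (e + g₂ + g₃) < e * h + 2 * c → ¬ e * h + 2 * (suc c * suc c) < suc c * (e + g₂ + g₃)
  lattice-lengths-incompatible c e h g₂ g₃ 2≤c 1≤g₂ 1≤g₃ g₂∣h g₃∣h g₂≤e g₃≤e equal⇒h∣e lower upper
    = by-cases (g₂ ≟ h) (g₃ ≟ h)
    where
    a = suc c
    expand : ∀ a e g₂ g₃ → a * (e + g₂ + g₃) ≡ a * e + a * g₂ + a * g₃
    expand = solve-∀
    a≤h : a ≤ h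
    a≤h with h ≤? c
    ... | no h≰c = ≰⇒> h≰c
    ... | yes h≤c = ⊥-elim (<⇒≱ lower (subst (e * h + 2 * c ≤_) (sym (expand c e g₂ g₃))
            (subst (_≤ c * e + c * g₂ + c * g₃) (regroup e h c)
              (+-mono-≤ (+-mono-≤ (subst (e * h ≤_) (*-comm e c) (*-monoʳ-≤ e h≤c)) (subst (_≤ c * g₂) (*-identityʳ c) (*-monoʳ-≤ c 1≤g₂)))
                        (subst (_≤ c * g₃) (*-identityʳ c) (*-monoʳ-≤ c 1≤g₃))))))
      where
      regroup : ∀ e h c → e * h + c + c ≡ e * h + 2 * c
      regroup = solve-∀
    a<e : a < e
    a<e = *-cancelˡ-< 2 a e (<-≤-trans 2a<g₂+g₃ (subst (g₂ + g₃ ≤_) (sym (cong (e +_) (+-identityʳ e))) (+-mono-≤ g₂≤e g₃≤e)))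
      where
      2a<g₂+g₃ : 2 * a < g₂ + g₃
      2a<g₂+g₃ = *-cancelˡ-< a (2 * a) (g₂ + g₃) (subst (_< a * (g₂ + g₃)) (regroup a) (+-cancelˡ-< (a * e) _ _
        (≤-<-trans (+-monoˡ-≤ (2 * (a * a)) (subst (_≤ e * h) (*-comm e a) (*-monoʳ-≤ e a≤h)))
                   (subst (e * h + 2 * (a * a) <_) (split a e g₂ g₃) upper))))
        where
        regroup : ∀ a → 2 * (a * a) ≡ a * (2 * a)
        regroup = solve-∀
        split : ∀ a e g₂ g₃ → a * (e + g₂ + g₃) ≡ a * e + a * (g₂ + g₃)
        split = solve-∀

    y = proj₁ (m≤n⇒∃[o]m+o≡n a≤h)
    h≡ : h ≡ a + y
    h≡ = sym (proj₂ (m≤n⇒∃[o]m+o≡n a≤h))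
    x = proj₁ (m≤n⇒∃[o]m+o≡n a<e)
    e≡ : e ≡ suc a + x
    e≡ = sym (proj₂ (m≤n⇒∃[o]m+o≡n a<e))
    upper′ : e * h + 2 * (a * a) < a * e + a * g₂ + a * g₃
    upper′ = subst (e * h + 2 * (a * a) <_) (expand a e g₂ g₃) upper

    full-proper : ∀ g → g ∣ h → g ≢ h → h ≤ e → ¬ e * h + 2 * (a * a) < a * e + a * h + a * g
    full-proper g g∣h g≢h h≤e lt = no-full-proper a y z
      (subst₂ (λ E H → 2 * (E * H + 2 * (a * a)) < 2 * (a * E) + 2 * (a * H) + a * H) e≡a+y+z h≡ doubled)
      where
      z = proj₁ (m≤n⇒∃[o]m+o≡n h≤e)
      e≡a+y+z : e ≡ a + y + z
      e≡a+y+z = trans (sym (proj₂ (m≤n⇒∃[o]m+o≡n h≤e))) (cong (_+ z) h≡)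
      doubled : 2 * (e * h + 2 * (a * a)) < 2 * (a * e) + 2 * (a * h) + a * h
      doubled = <-≤-trans (*-monoʳ-< 2 lt) (subst (_≤ 2 * (a * e) + 2 * (a * h) + a * h) (sym (distrib a e h g))
        (+-monoʳ-≤ (2 * (a * e) + 2 * (a * h)) (*-monoʳ-≤ a (2*proper-divisor≤ g∣h g≢h))))
        where
        distrib : ∀ a e h g → 2 * (a * e + a * h + a * g) ≡ 2 * (a * e) + 2 * (a * h) + a * (2 * g)
        distrib = solve-∀

    by-cases : Dec (g₂ ≡ h) → Dec (g₃ ≡ h) → ⊥
    by-cases (no g₂≢h) (no g₃≢h) =
      no-proper-proper a x y (subst₂ (λ E H → E * H + 2 * (a * a) < a * E + a * H) e≡ h≡ upper-proper-proper)
      where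
      g₂+g₃≤h : g₂ + g₃ ≤ h
      g₂+g₃≤h = *-cancelˡ-≤ 2 (subst (_≤ 2 * h) (sym (*-distribˡ-+ 2 g₂ g₃))
        (subst (2 * g₂ + 2 * g₃ ≤_) (sym (cong (h +_) (+-identityʳ h)))
          (+-mono-≤ (2*proper-divisor≤ g₂∣h g₂≢h) (2*proper-divisor≤ g₃∣h g₃≢h))))
      upper-proper-proper : e * h + 2 * (a * a) < a * e + a * h
      upper-proper-proper = <-≤-trans upper′ (subst (_≤ a * e + a * h) (sym (+-assoc (a * e) (a * g₂) (a * g₃)))
        (+-monoʳ-≤ (a * e) (subst (_≤ a * h) (*-distribˡ-+ a g₂ g₃) (*-monoʳ-≤ a g₂+g₃≤h))))
    by-cases (yes g₂≡h) (no g₃≢h) = full-proper g₃ g₃∣h g₃≢h (subst (_≤ e) g₂≡h g₂≤e)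
      (subst (λ G → e * h + 2 * (a * a) < a * e + a * G + a * g₃) g₂≡h upper′)
    by-cases (no g₂≢h) (yes g₃≡h) = full-proper g₂ g₂∣h g₂≢h (subst (_≤ e) g₃≡h g₃≤e)
      (subst (e * h + 2 * (a * a) <_) (swap (a * e) (a * g₂) (a * h))
        (subst (λ G → e * h + 2 * (a * a) < a * e + a * g₂ + a * G) g₃≡h upper′))
      where
      swap : ∀ p q s → p + q + s ≡ p + s + q
      swap = solve-∀
    by-cases (yes g₂≡h) (yes g₃≡h) = no-full-full x w 1≤x+w
      (subst (λ C → C * (H C + H C + H C) < H C * H C + 2 * C) c≡
        (subst (λ K → c * (K + K + K) < K * K + 2 * c) h≡H
          (subst (λ E → c * (E + h + h) < E * h + 2 * c) e≡h
            (subst₂ (λ G₂ G₃ → c * (e + G₂ + G₃) < e * h + 2 * c) g₂≡h g₃≡h lower))))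
      where
      H : ℕ → ℕ
      H C = suc C + suc x
      1+x<a : suc x < a
      1+x<a = full-full⇒1+x<a a x y (subst₂ (λ E K → E * K + 2 * (a * a) < a * E + a * K + a * K) e≡ h≡
        (subst₂ (λ G₂ G₃ → e * h + 2 * (a * a) < a * e + a * G₂ + a * G₃) g₂≡h g₃≡h upper′))
      e<h+h : e < h + h
      e<h+h = subst (_< h + h) (sym e≡) (subst (suc a + x <_) (sym (cong₂ _+_ h≡ h≡))
        (<-≤-trans (subst (_< a + a) (+-suc a x) (+-monoʳ-< a 1+x<a)) (+-mono-≤ (m≤m+n a y) (m≤m+n a y))))
      -- h ∣ e and 0 < e < 2 h
      e≡h : e ≡ h
      e≡h with equal⇒h∣e g₂≡h g₃≡h
      ... | divides zero e≡0 = ⊥-elim (0≢1+n (sym (trans (sym e≡) e≡0)))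
      ... | divides (suc zero) e≡h+0 = trans e≡h+0 (+-identityʳ h)
      ... | divides (suc (suc q)) e≡qh = ⊥-elim (<⇒≱ e<h+h (subst (h + h ≤_) (sym e≡qh) (+-monoʳ-≤ h (m≤m+n h (q * h)))))
      y≡1+x : y ≡ suc x
      y≡1+x = +-cancelˡ-≡ a y (suc x) (trans (sym h≡) (trans (sym e≡h) (trans e≡ (sym (+-suc a x)))))
      h≡H : h ≡ H c
      h≡H = trans h≡ (cong (a +_) y≡1+x)
      w = proj₁ (m≤n⇒∃[o]m+o≡n (s≤s⁻¹ 1+x<a))
      c≡ : c ≡ suc (x + w)
      c≡ = sym (proj₂ (m≤n⇒∃[o]m+o≡n (s≤s⁻¹ 1+x<a)))
      1≤x+w : 1 ≤ x + w
      1≤x+w = s≤s⁻¹ (subst (2 ≤_) c≡ 2≤c)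

open import Defs
open Counting
open Symmetries
open NormalForm
open StandardCount
open Arithmetic
open import Data.Nat as ℕ using (ℕ; NonZero)
import Data.Nat.Properties as ℕP
open import Data.Nat.Divisibility using (_∣_; ∣m+n∣m⇒∣n)
open import Data.Nat.GCD using (gcd; gcd[m,n]∣m; gcd[m,n]∣n; gcd[m,n]≡0⇒m≡0)
open import Data.Integer using (0ℤ; +_; _+_; _-_; _*_; _<_; ∣_∣; -_)
import Data.Integer.Properties as ℤP
open import Data.Integer.Tactic.RingSolver
open import Data.Product using (_×_; _,_)
open import Relation.Nullary using (¬_; yes; no)
open import Relation.Binary.PropositionalEquality

edgeLength-comm : ∀ p q → edgeLength p q ≡ edgeLength q p
edgeLength-comm (p₁ , p₂) (q₁ , q₂) = cong₂ gcd (∣-∣-comm q₁ p₁) (∣-∣-comm q₂ p₂)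
  where
  ∣-∣-comm : ∀ a c → ∣ a - c ∣ ≡ ∣ c - a ∣
  ∣-∣-comm a c = trans (cong ∣_∣ (negate a c)) (ℤP.∣-i∣≡∣i∣ (c - a))
    where
    negate : ∀ a c → a - c ≡ - (c - a)
    negate = solve-∀

record LongestEdgeFirst (T : LatticeTriangle) : Set where
  field
    reordered : LatticeTriangle
    counts : SameCounts T reordered
    edge₁₃≤edge₁₂ : edgeLength (v₁ reordered) (v₃ reordered) ℕ.≤ edgeLength (v₁ reordered) (v₂ reordered)
    edge₂₃≤edge₁₂ : edgeLength (v₂ reordered) (v₃ reordered) ℕ.≤ edgeLength (v₁ reordered) (v₂ reordered)

module _ {p q r : Point} (nd : ¬ det p q r ≡ 0ℤ) where
  private T = triangle p q r nd

  qr-longest : edgeLength p q ℕ.≤ edgeLength q r → edgeLength p r ℕ.≤ edgeLength q r → LongestEdgeFirst T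
  qr-longest pq≤qr pr≤qr = record
    { reordered = rotate T ; counts = rotate-SameCounts T
    ; edge₁₃≤edge₁₂ = subst (ℕ._≤ edgeLength q r) (edgeLength-comm p q) pq≤qr
    ; edge₂₃≤edge₁₂ = subst (ℕ._≤ edgeLength q r) (edgeLength-comm p r) pr≤qr }

  pr-longest : edgeLength q r ℕ.≤ edgeLength p r → edgeLength p q ℕ.≤ edgeLength p r → LongestEdgeFirst T
  pr-longest qr≤pr pq≤pr = record
    { reordered = rotate (rotate T) ; counts = SameCounts-trans (rotate-SameCounts T) (rotate-SameCounts (rotate T))
    ; edge₁₃≤edge₁₂ = subst₂ ℕ._≤_ (edgeLength-comm q r) (edgeLength-comm p r) qr≤pr
    ; edge₂₃≤edge₁₂ = subst (edgeLength p q ℕ.≤_) (edgeLength-comm p r) pq≤pr }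

opaque
  longestEdgeFirst : ∀ T → LongestEdgeFirst T
  longestEdgeFirst T@(triangle p q r nd) with edgeLength p r ℕ.≤? edgeLength p q | edgeLength q r ℕ.≤? edgeLength p q
                                            | edgeLength q r ℕ.≤? edgeLength p r
  ... | yes pr≤pq | yes qr≤pq | _ = record { reordered = T ; counts = sameCounts refl refl ; edge₁₃≤edge₁₂ = pr≤pq ; edge₂₃≤edge₁₂ = qr≤pq }
  ... | yes pr≤pq | no qr≰pq | _ = qr-longest nd (ℕP.<⇒≤ (ℕP.≰⇒> qr≰pq)) (ℕP.≤-trans pr≤pq (ℕP.<⇒≤ (ℕP.≰⇒> qr≰pq)))
  ... | no pr≰pq | _ | yes qr≤pr = pr-longest nd qr≤pr (ℕP.<⇒≤ (ℕP.≰⇒> pr≰pq))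
  ... | no pr≰pq | _ | no qr≰pr = qr-longest nd (ℕP.<⇒≤ (ℕP.<-trans (ℕP.≰⇒> pr≰pq) (ℕP.≰⇒> qr≰pr))) (ℕP.<⇒≤ (ℕP.≰⇒> qr≰pr))

record PickData (T : LatticeTriangle) : Set where
  field
    e h g₂ g₃ : ℕ
    h-nonZero : NonZero h
    b≡ : b T ≡ e ℕ.+ g₂ ℕ.+ g₃
    pick : 2 ℕ.* i T ℕ.+ b T ≡ e ℕ.* h ℕ.+ 2
    1≤g₂ : 1 ℕ.≤ g₂
    1≤g₃ : 1 ℕ.≤ g₃
    g₂∣h : g₂ ∣ h
    g₃∣h : g₃ ∣ h
    g₂≤e : g₂ ℕ.≤ e
    g₃≤e : g₃ ℕ.≤ e
    g₂≡h⇒g₃≡h⇒h∣e : g₂ ≡ h → g₃ ≡ h → h ∣ e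

pickData : ∀ T → PickData T
pickData T = record
  { e = e ; h = h ; g₂ = gcd h (e ℕ.+ r) ; g₃ = gcd h r ; h-nonZero = h-nonZero
  ; b≡ = trans b≡b-standard (StandardTriangle.b-standard e h r)
  ; pick = trans (cong₂ (λ x y → 2 ℕ.* x ℕ.+ y) i≡i-standard b≡b-standard) (StandardTriangle.pick-standard e h r)
  ; 1≤g₂ = 1≤gcd (e ℕ.+ r) ; 1≤g₃ = 1≤gcd r
  ; g₂∣h = gcd[m,n]∣m h (e ℕ.+ r) ; g₃∣h = gcd[m,n]∣m h r
  ; g₂≤e = subst₂ ℕ._≤_ edge₁₃ edge₁₂ edge₁₃≤edge₁₂
  ; g₃≤e = subst₂ ℕ._≤_ edge₂₃ edge₁₂ edge₂₃≤edge₁₂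
  ; g₂≡h⇒g₃≡h⇒h∣e = λ g₂≡h g₃≡h →
      ∣m+n∣m⇒∣n (subst (h ∣_) (ℕP.+-comm e r) (subst (_∣ e ℕ.+ r) g₂≡h (gcd[m,n]∣n h (e ℕ.+ r))))
                (subst (_∣ r) g₃≡h (gcd[m,n]∣n h r)) }
  where
  open LongestEdgeFirst (longestEdgeFirst T) renaming (counts to T≈reordered)
  open StandardForm (standardForm reordered) renaming (counts to reordered≈standard)
  instance
    e≢0 : NonZero e
    e≢0 = e-nonZero
    h≢0 : NonZero h
    h≢0 = h-nonZero
  T≈standard : SameCounts T (standard e h r)
  T≈standard = SameCounts-trans T≈reordered reordered≈standard
  b≡b-standard : b T ≡ b (standard e h r)
  b≡b-standard = SameCounts.b≡ T≈standard
  i≡i-standard : i T ≡ i (standard e h r)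
  i≡i-standard = SameCounts.i≡ T≈standard
  1≤gcd : ∀ n → 1 ℕ.≤ gcd h n
  1≤gcd n = ℕP.n≢0⇒n>0 (λ gcd≡0 → ℕ.≢-nonZero⁻¹ h (gcd[m,n]≡0⇒m≡0 gcd≡0))

pos-+-* : ∀ m n o → + (m ℕ.+ n ℕ.* o) ≡ + m + + n * + o
pos-+-* m n o = trans (ℤP.pos-+ m (n ℕ.* o)) (cong (λ x → + m + x) (ℤP.pos-* n o))

module _ (c B I E : ℕ) (pick : 2 ℕ.* I ℕ.+ B ≡ E ℕ.+ 2) where

  private
    2I+B≡E+2 : + 2 * + I + + B ≡ + E + + 2
    2I+B≡E+2 = trans (cong (_+ + B) (sym (ℤP.pos-* 2 I))) (trans (sym (ℤP.pos-+ (2 ℕ.* I) B)) (trans (cong +_ pick) (ℤP.pos-+ E 2)))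

  i-lower-bound⇒ : (+ c - + 1) * + B - + 2 * (+ c - + 1) < + 2 * + I → c ℕ.* B ℕ.< E ℕ.+ 2 ℕ.* c
  i-lower-bound⇒ lt = ℤP.drop‿+<+ (subst₂ _<_ lhs rhs (ℤP.+-monoˡ-< (+ B + + 2 * (+ c - + 1)) lt))
    where
    lhs : (+ c - + 1) * + B - + 2 * (+ c - + 1) + (+ B + + 2 * (+ c - + 1)) ≡ + (c ℕ.* B)
    lhs = trans (identity (+ c) (+ B)) (sym (ℤP.pos-* c B))
      where
      identity : ∀ C B → (C - + 1) * B - + 2 * (C - + 1) + (B + + 2 * (C - + 1)) ≡ C * B
      identity = solve-∀
    rhs : + 2 * + I + (+ B + + 2 * (+ c - + 1)) ≡ + (E ℕ.+ 2 ℕ.* c)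
    rhs = begin
      + 2 * + I + (+ B + + 2 * (+ c - + 1))   ≡⟨ regroup (+ I) (+ B) (+ c) ⟩
      (+ 2 * + I + + B) + + 2 * + c - + 2     ≡⟨ cong (λ x → x + + 2 * + c - + 2) 2I+B≡E+2 ⟩
      (+ E + + 2) + + 2 * + c - + 2           ≡⟨ cancel (+ E) (+ c) ⟩
      + E + + 2 * + c                         ≡⟨ pos-+-* E 2 c ⟨
      + (E ℕ.+ 2 ℕ.* c)                       ∎
      where
      open ≡-Reasoning
      regroup : ∀ I B C → + 2 * I + (B + + 2 * (C - + 1)) ≡ (+ 2 * I + B) + + 2 * C - + 2
      regroup = solve-∀
      cancel : ∀ E C → (E + + 2) + + 2 * C - + 2 ≡ E + + 2 * C
      cancel = solve-∀

  i-upper-bound⇒ : + 2 * + I < + c * + B - + 2 * + c * (+ c + + 2) → E ℕ.+ 2 ℕ.* (ℕ.suc c ℕ.* ℕ.suc c) ℕ.< ℕ.suc c ℕ.* B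
  i-upper-bound⇒ lt = ℤP.drop‿+<+ (subst₂ _<_ lhs rhs (ℤP.+-monoˡ-< (+ B + + 2 * + c * (+ c + + 2)) lt))
    where
    lhs : + 2 * + I + (+ B + + 2 * + c * (+ c + + 2)) ≡ + (E ℕ.+ 2 ℕ.* (ℕ.suc c ℕ.* ℕ.suc c))
    lhs = begin
      + 2 * + I + (+ B + + 2 * + c * (+ c + + 2))   ≡⟨ regroup (+ I) (+ B) (+ c) ⟩
      (+ 2 * + I + + B) + + 2 * + c * (+ c + + 2)   ≡⟨ cong (λ x → x + + 2 * + c * (+ c + + 2)) 2I+B≡E+2 ⟩
      (+ E + + 2) + + 2 * + c * (+ c + + 2)         ≡⟨ complete-square (+ E) (+ c) ⟩
      + E + + 2 * ((+ 1 + + c) * (+ 1 + + c))       ≡⟨ cong (λ x → + E + + 2 * x) (ℤP.pos-* (ℕ.suc c) (ℕ.suc c)) ⟨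
      + E + + 2 * + (ℕ.suc c ℕ.* ℕ.suc c)           ≡⟨ pos-+-* E 2 (ℕ.suc c ℕ.* ℕ.suc c) ⟨
      + (E ℕ.+ 2 ℕ.* (ℕ.suc c ℕ.* ℕ.suc c))        ∎
      where
      open ≡-Reasoning
      regroup : ∀ I B C → + 2 * I + (B + + 2 * C * (C + + 2)) ≡ (+ 2 * I + B) + + 2 * C * (C + + 2)
      regroup = solve-∀
      complete-square : ∀ E C → (E + + 2) + + 2 * C * (C + + 2) ≡ E + + 2 * ((+ 1 + C) * (+ 1 + C))
      complete-square = solve-∀
    rhs : + c * + B - + 2 * + c * (+ c + + 2) + (+ B + + 2 * + c * (+ c + + 2)) ≡ + (ℕ.suc c ℕ.* B)
    rhs = trans (identity (+ c) (+ B)) (sym (ℤP.pos-* (ℕ.suc c) B))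
      where
      identity : ∀ C B → C * B - + 2 * C * (C + + 2) + (B + + 2 * C * (C + + 2)) ≡ (+ 1 + C) * B
      identity = solve-∀

theorem2 : (c : ℕ) → 2 ℕ.≤ c → (T : LatticeTriangle) →
    ¬ (((+ c - + 1) * + b T - + 2 * (+ c - + 1) < + 2 * + i T) ×
       (+ 2 * + i T < + c * + b T - + 2 * + c * (+ c + + 2)))
theorem2 c 2≤c T (lower , upper) =
  lattice-lengths-incompatible c e h g₂ g₃ {{h-nonZero}} 2≤c 1≤g₂ 1≤g₃ g₂∣h g₃∣h g₂≤e g₃≤e g₂≡h⇒g₃≡h⇒h∣e
    (subst (λ B → c ℕ.* B ℕ.< e ℕ.* h ℕ.+ 2 ℕ.* c) b≡ (i-lower-bound⇒ c (b T) (i T) (e ℕ.* h) pick lower))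
    (subst (λ B → e ℕ.* h ℕ.+ 2 ℕ.* (ℕ.suc c ℕ.* ℕ.suc c) ℕ.< ℕ.suc c ℕ.* B) b≡ (i-upper-bound⇒ c (b T) (i T) (e ℕ.* h) pick upper))
  where open PickData (pickData T)
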